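{- Let $c\in\mathbb{Q}$. For every $n\ge1$, \[ q_n^{(c)}=-\frac{1}{(n-1)!}\sum_{|\boldsymbol{l}|=n}a(\boldsymbol{l})\,w(\boldsymbol{l}), \] where the sum runs over all indices $\boldsymbol{l}=(l_1,\dots,l_s)\in\mathbb{N}^s$ (positive integers, any length $s\ge1$) with $l_1+\cdots+l_s=n$, and $w(\boldsymbol{l})=(-1)^s\,yz^{l_1-1}yz^{l_2-1}\cdots yz^{l_s-1}$.
   Context: Let $\mathfrak{H}=\mathbb{Q}\langle x,y\rangle$ be the noncommutative polynomial algebra in $x,y$, and set $z=x+y$. $\partial_1$ is the $\mathbb{Q}$-linear derivation of $\mathfrak{H}$ with $\partial_1(x)=yx$, $\partial_1(y)=-yx$. Let $H:\mathfrak{H}\to\mathfrak{H}$ be the $\mathbb{Q}$-linear map with $H(w)=\deg(w)\,w$ for every monomial $w$. For $c\in\mathbb{Q}$, $\theta=\theta^{(c)}$ is the unique $\mathbb{Q}$-linear map with $\theta(1)=0$, $\theta(x)=xz$, $\theta(y)=yz$ and $\theta(ww')=\theta(w)w'+w\theta(w')+cH(w)\partial_1(w')$ for all $w,w'\in\mathfrak{H}$; $\tilde\theta(w)=\theta(w)+cH(w)y$; and $q_n^{(c)}=\frac{1}{(n-1)!}\tilde\theta^{\,n-1}(y)$. The rational numbers $a(\boldsymbol{l})$ for indices $\boldsymbol{l}=(l_1,\dots,l_s)$ of positive integers are defined recursively (on the weight $l_1+\cdots+l_s$) by $a(1)=1$ and, for weight at least $2$, $a(\boldsymbol{l})=\sum_{i=1}^{s}\bigl(l_i-1-(l_1+\cdots+l_{i-1})c\bigr)\,a(\boldsymbol{l}^{(i)})$,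 where $\boldsymbol{l}^{(i)}=(l_1,\dots,l_{i-1},l_{i+1},\dots,l_s)$ if $l_i=1$ and $\boldsymbol{l}^{(i)}=(l_1,\dots,l_{i-1},l_i-1,l_{i+1},\dots,l_s)$ if $l_i>1$. -}

module Defs where

open import Data.Bool using (Bool; true; false; if_then_else_)
open import Data.Nat as ℕ using (ℕ; zero; suc; _!; _∸_)
open import Data.Nat.Properties using (_!≢0)
open import Data.Integer using (+_)
open import Data.Rational using (ℚ; 0ℚ; 1ℚ; _+_; _*_; _-_; -_; _/_)
import Data.Rational as ℚ
open import Data.List using (List; []; _∷_; [_]; _++_; map; concatMap; foldr; length; take; drop; lookup; allFin)
open import Data.Nat.ListAction using (sum)
open import Data.Fin using (Fin; toℕ)
open import Data.Product using (_×_; _,_)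
open import Relation.Nullary using (yes; no)
open import Relation.Binary.PropositionalEquality using (_≡_; refl)

-- The free algebra 𝔥 = ℚ⟨x,y⟩.  Two polynomials are equal in 𝔥 iff all
-- their coefficients (see `coeff`) agree.

data Letter : Set where
  x y : Letter

Word : Set
Word = List Letter

Poly : Set
Poly = List (ℚ × Word)

_≟L_ : Letter → Letter → Bool
x ≟L x = true
y ≟L y = true
x ≟L y = false
y ≟L x = false

_≟W_ : Word → Word → Bool
[] ≟W [] = true
(a ∷ u) ≟W (b ∷ v) = if a ≟L b then u ≟W v else false
[] ≟W (_ ∷ _) = false
(_ ∷ _) ≟W [] = false

coeff : Poly → Word → ℚ
coeff [] w = 0ℚ
coeff ((q , u) ∷ p) w = (if u ≟W w then q else 0ℚ) + coeff p w

mon : Word → Poly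
mon w = [ (1ℚ , w) ]

one : Poly
one = mon []

_⊕_ : Poly → Poly → Poly
p ⊕ r = p ++ r

_·_ : ℚ → Poly → Poly
q · p = map (λ { (r , w) → (q * r , w) }) p

_⊗_ : Poly → Poly → Poly
p ⊗ r = concatMap (λ { (a , u) → map (λ { (b , v) → (a * b , u ++ v) }) r }) p

infixl 6 _⊕_
infixl 7 _⊗_
infixr 8 _·_

_^_ : Poly → ℕ → Poly
p ^ zero = one
p ^ suc k = p ⊗ (p ^ k)

linear : (Word → Poly) → Poly → Poly
linear f p = concatMap (λ { (q , w) → q · f w }) p

X Y Z : Poly
X = mon [ x ]
Y = mon [ y ]
Z = X ⊕ Y

∂₁L : Letter → Poly
∂₁L x = Y ⊗ X
∂₁L y = (- 1ℚ) · (Y ⊗ X)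

∂₁W : Word → Poly
∂₁W [] = []
∂₁W (a ∷ r) = ∂₁L a ⊗ mon r ⊕ mon [ a ] ⊗ ∂₁W r

∂₁ : Poly → Poly
∂₁ = linear ∂₁W

H : Poly → Poly
H = map (λ { (q , w) → (q * (+ length w / 1) , w) })

module _ (c : ℚ) where
  -- θ = θ^(c): θ(1) = 0, θ(a) = a z for letters a, and
  -- θ(ww') = θ(w)w' + wθ(w') + c H(w) ∂₁(w').  Splitting off the first
  -- letter a of a word (H(a) = a) determines θ uniquely on words:
  θW : Word → Poly
  θW [] = []
  θW (a ∷ r) = mon [ a ] ⊗ Z ⊗ mon r ⊕ mon [ a ] ⊗ θW r ⊕ c · (mon [ a ] ⊗ ∂₁W r)

  θ : Poly → Poly
  θ = linear θW

  θ̃ : Poly → Poly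
  θ̃ p = θ p ⊕ c · (H p ⊗ Y)

  iter : ℕ → (Poly → Poly) → Poly → Poly
  iter zero f p = p
  iter (suc k) f p = f (iter k f p)

  qn : ℕ → Poly
  qn n = ((+ 1) / ((n ∸ 1) !)) {{(n ∸ 1) !≢0}} · iter (n ∸ 1) θ̃ Y

  weight : List ℕ → ℕ
  weight = sum

  ℚ[_] : ℕ → ℚ
  ℚ[ k ] = + k / 1

  remove : (l : List ℕ) → Fin (length l) → List ℕ
  remove l i = take (toℕ i) l ++ step (lookup l i) ++ drop (suc (toℕ i)) l
    where
    step : ℕ → List ℕ
    step (suc (suc k)) = [ suc k ]
    step _ = []   -- l_i = 1 (l_i = 0 does not occur for indices)

  -- a(l), by recursion on the weight (the fuel argument equals weight l)
  sumℚ : List ℚ → ℚ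
  sumℚ = foldr _+_ 0ℚ

  aF : ℕ → List ℕ → ℚ
  aF zero l = 0ℚ              -- weight 0: never used
  aF (suc zero) l = 1ℚ
  aF (suc (suc f)) l =
    sumℚ (map (λ i → (ℚ[ lookup l i ] - 1ℚ - ℚ[ weight (take (toℕ i) l) ] * c)
                    * aF (suc f) (remove l i))
             (allFin (length l)))

  a : List ℕ → ℚ
  a l = aF (weight l) l

-- all indices (compositions) of weight n, with positive entries;
-- compF f n with fuel f ≥ n
compF : ℕ → ℕ → List (List ℕ)
compF _ zero = [ [] ]
compF zero (suc n) = []
compF (suc f) (suc n) =
  concatMap (λ k → map (suc (toℕ k) ∷_) (compF f (n ∸ toℕ k))) (allFin (suc n))

indices : ℕ → List (List ℕ)
indices n = compF n n

wordPart : List ℕ → Poly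
wordPart [] = one
wordPart (l ∷ ls) = Y ⊗ (Z ^ (l ∸ 1)) ⊗ wordPart ls

sign : ℕ → ℚ
sign zero = 1ℚ
sign (suc s) = (- 1ℚ) * sign s

wl : List ℕ → Poly
wl l = sign (length l) · wordPart l

rhs : ℚ → ℕ → Poly
rhs c n = (ℚ.- ((+ 1) / ((n ∸ 1) !)) {{(n ∸ 1) !≢0}})
          · concatMap (λ l → a c l · wl l) (indices n)

-- Let S n = Σ_{|l|=n} a(l) w(l), so that the claim reads θ̃^(n−1)(y) = −S n; since S 1 = −y
-- it suffices to show θ̃(S n) = S (n+1).  For Θ_K = θ + cK∂₁ the defining rule of θ becomes
-- the twisted Leibniz rule Θ_K(pr) = Θ_K(p) r + p Θ_{K+deg p}(r), and Θ_K(z) = z²,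
-- Θ_K(y z^j) = (j+1−cK) y z^(j+1) + cK y y z^j.  Hence θ̃(w(l)) is a combination of the w(l′)
-- over the children l′ of l, i.e. the indices with l′^(i) = l for some i: either l_i grows by
-- one, with coefficient l_i − (l₁+⋯+l_{i−1})c, or a part 1 is inserted at position i (at the
-- end this comes from the term cH(w)y of θ̃), with coefficient −(l₁+⋯+l_{i−1})c after the sign
-- change.  Each pair (l′, i) has exactly one parent, so regrouping by l′ gives exactly the
-- recursion defining a(l′).

module Submission where

open import Defs
open import Data.Bool using (Bool; true; false; if_then_else_)
open import Data.Nat as ℕ using (ℕ; zero; suc; _≤_; _<_; z≤n; s≤s; _∸_; _!)
import Data.Nat.Properties as ℕP
open import Data.Nat.Properties using (_!≢0)
open import Data.Nat.ListAction using (sum)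
import Data.Integer as ℤ
open import Data.Rational using (ℚ; toℚᵘ; 0ℚ; 1ℚ; _+_; _*_; _-_; -_; _/_)
import Data.Rational.Properties as QP
import Data.Rational.Unnormalised as U
import Data.Rational.Unnormalised.Properties as UP
import Data.Integer.Solver as ℤSolver
open import Data.Rational.Solver using (module +-*-Solver)
open +-*-Solver using (solve; _:+_; _:*_; _:=_; con; :-_; _:-_)
open import Data.List using (List; []; _∷_; [_]; _++_; map; concatMap; length; take; drop; lookup; allFin; tabulate)
import Data.List.Properties as LP
open import Data.List.Relation.Unary.All as All using (All; []; _∷_)
import Data.List.Relation.Unary.All.Properties as AllP
open import Data.Fin using (Fin; toℕ) renaming (zero to fzero; suc to fsuc)
import Data.Fin.Properties as FP
open import Data.Product using (_×_; _,_; proj₁; proj₂)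
open import Relation.Binary.PropositionalEquality using (_≡_; refl; sym; trans; cong; cong₂)
open Relation.Binary.PropositionalEquality.≡-Reasoning

infix 4 _≈_
record _≈_ (p r : Poly) : Set where
  constructor ≈i
  field at : ∀ w → coeff p w ≡ coeff r w
open _≈_ public

≈-refl : ∀ {p} → p ≈ p
≈-refl = ≈i λ w → refl

≈-sym : ∀ {p r} → p ≈ r → r ≈ p
≈-sym e = ≈i λ w → sym (at e w)

≈-trans : ∀ {p r s} → p ≈ r → r ≈ s → p ≈ s
≈-trans e f = ≈i λ w → trans (at e w) (at f w)

≡⇒≈ : ∀ {p r} → p ≡ r → p ≈ r
≡⇒≈ refl = ≈-refl

≟L-refl : ∀ a → (a ≟L a) ≡ true
≟L-refl x = refl
≟L-refl y = refl

≟W-refl : ∀ u → (u ≟W u) ≡ true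
≟W-refl [] = refl
≟W-refl (a ∷ u) rewrite ≟L-refl a = ≟W-refl u

≟L⇒≡ : ∀ a b → (a ≟L b) ≡ true → a ≡ b
≟L⇒≡ x x _ = refl
≟L⇒≡ y y _ = refl

≟W⇒≡ : ∀ u v → (u ≟W v) ≡ true → u ≡ v
≟W⇒≡ [] [] _ = refl
≟W⇒≡ (a ∷ u) (b ∷ v) e with a ≟L b in eq
... | true = cong₂ _∷_ (≟L⇒≡ a b eq) (≟W⇒≡ u v e)

coeff-++ : ∀ p r w → coeff (p ++ r) w ≡ coeff p w + coeff r w
coeff-++ [] r w = sym (QP.+-identityˡ _)
coeff-++ ((q , u) ∷ p) r w =
  trans (cong ((if u ≟W w then q else 0ℚ) +_) (coeff-++ p r w))
        (sym (QP.+-assoc (if u ≟W w then q else 0ℚ) (coeff p w) (coeff r w)))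

if-* : ∀ (b : Bool) s q → (if b then s * q else 0ℚ) ≡ s * (if b then q else 0ℚ)
if-* true s q = refl
if-* false s q = sym (QP.*-zeroʳ s)

coeff-· : ∀ s p w → coeff (s · p) w ≡ s * coeff p w
coeff-· s [] w = sym (QP.*-zeroʳ s)
coeff-· s ((q , u) ∷ p) w =
  trans (cong₂ _+_ (if-* (u ≟W w) s q) (coeff-· s p w)) (sym (QP.*-distribˡ-+ s _ _))

coeff-·⊕· : ∀ s p t r w → coeff (s · p ⊕ t · r) w ≡ s * coeff p w + t * coeff r w
coeff-·⊕· s p t r w = trans (coeff-++ (s · p) (t · r) w) (cong₂ _+_ (coeff-· s p w) (coeff-· t r w))

coeff-linear-∷ : ∀ f s u p w →
  coeff (linear f ((s , u) ∷ p)) w ≡ s * coeff (f u) w + coeff (linear f p) w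
coeff-linear-∷ f s u p w =
  trans (coeff-++ (s · f u) (linear f p) w) (cong (_+ coeff (linear f p) w) (coeff-· s (f u) w))

linear-++ : ∀ f p r → linear f (p ++ r) ≡ linear f p ++ linear f r
linear-++ f p r = LP.concatMap-++ _ p r

coeff-linear-· : ∀ f s p w → coeff (linear f (s · p)) w ≡ s * coeff (linear f p) w
coeff-linear-· f s [] w = sym (QP.*-zeroʳ s)
coeff-linear-· f s ((q , u) ∷ p) w = begin
  coeff (linear f ((s * q , u) ∷ (s · p))) w        ≡⟨ coeff-linear-∷ f (s * q) u (s · p) w ⟩
  s * q * F + coeff (linear f (s · p)) w           ≡⟨ cong (s * q * F +_) (coeff-linear-· f s p w) ⟩
  s * q * F + s * R                                ≡⟨ solve 4 (λ s q F R → s :* q :* F :+ s :* R := s :* (q :* F :+ R)) refl s q F R ⟩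
  s * (q * F + R)                                  ≡⟨ cong (s *_) (sym (coeff-linear-∷ f q u p w)) ⟩
  s * coeff (linear f ((q , u) ∷ p)) w             ∎
  where
  F = coeff (f u) w
  R = coeff (linear f p) w

linear-cong : ∀ {f g} → (∀ u → f u ≈ g u) → ∀ p → linear f p ≈ linear g p
linear-cong e [] = ≈-refl
linear-cong {f} {g} e ((s , u) ∷ p) = ≈i λ w → begin
  coeff (linear f ((s , u) ∷ p)) w            ≡⟨ coeff-linear-∷ f s u p w ⟩
  s * coeff (f u) w + coeff (linear f p) w    ≡⟨ cong₂ _+_ (cong (s *_) (at (e u) w)) (at (linear-cong e p) w) ⟩
  s * coeff (g u) w + coeff (linear g p) w    ≡⟨ sym (coeff-linear-∷ g s u p w) ⟩
  coeff (linear g ((s , u) ∷ p)) w            ∎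

-- A polynomial may repeat words, so `linear f` respecting ≈ is proved by deleting one
-- word at a time, whose coefficient collects all of its occurrences.
deleteWord : Word → Poly → Poly
deleteWord u [] = []
deleteWord u ((q , v) ∷ p) = if v ≟W u then deleteWord u p else (q , v) ∷ deleteWord u p

length-deleteWord : ∀ u p → length (deleteWord u p) ≤ length p
length-deleteWord u [] = z≤n
length-deleteWord u ((q , v) ∷ p) with v ≟W u
... | true = ℕP.m≤n⇒m≤1+n (length-deleteWord u p)
... | false = s≤s (length-deleteWord u p)

coeff-deleteWord : ∀ u p w → coeff (deleteWord u p) w ≡ (if u ≟W w then 0ℚ else coeff p w)
coeff-deleteWord u [] w with u ≟W w
... | true = refl
... | false = refl
coeff-deleteWord u ((q , v) ∷ p) w with v ≟W u in v≡u
... | true with ≟W⇒≡ v u v≡u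
... | refl = trans (coeff-deleteWord u p w) (drop-head (u ≟W w))
  where
  drop-head : ∀ b → (if b then 0ℚ else coeff p w) ≡ (if b then 0ℚ else (if b then q else 0ℚ) + coeff p w)
  drop-head true = refl
  drop-head false = sym (QP.+-identityˡ _)
coeff-deleteWord u ((q , v) ∷ p) w | false =
  trans (cong (head +_) (coeff-deleteWord u p w)) (keep-head (u ≟W w) refl)
  where
  head = if v ≟W w then q else 0ℚ
  keep-head : ∀ b → (u ≟W w) ≡ b → head + (if b then 0ℚ else coeff p w) ≡ (if b then 0ℚ else head + coeff p w)
  keep-head false _ = refl
  keep-head true u≡w with ≟W⇒≡ u w u≡w
  ... | refl rewrite v≡u = QP.+-identityˡ _

coeff-linear-deleteWord : ∀ f u p w →
  coeff (linear f p) w ≡ coeff p u * coeff (f u) w + coeff (linear f (deleteWord u p)) w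
coeff-linear-deleteWord f u [] w =
  sym (trans (cong (_+ 0ℚ) (QP.*-zeroˡ (coeff (f u) w))) (QP.+-identityˡ 0ℚ))
coeff-linear-deleteWord f u ((q , v) ∷ p) w with v ≟W u in v≡u
... | true with ≟W⇒≡ v u v≡u
... | refl = begin
  coeff (linear f ((q , v) ∷ p)) w   ≡⟨ coeff-linear-∷ f q v p w ⟩
  q * F + coeff (linear f p) w       ≡⟨ cong (q * F +_) (coeff-linear-deleteWord f v p w) ⟩
  q * F + (coeff p v * F + R)        ≡⟨ solve 4 (λ q a F R → q :* F :+ (a :* F :+ R) := (q :+ a) :* F :+ R) refl q (coeff p v) F R ⟩
  (q + coeff p v) * F + R            ∎
  where
  F = coeff (f v) w
  R = coeff (linear f (deleteWord v p)) w
coeff-linear-deleteWord f u ((q , v) ∷ p) w | false = begin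
  coeff (linear f ((q , v) ∷ p)) w          ≡⟨ coeff-linear-∷ f q v p w ⟩
  q * G + coeff (linear f p) w              ≡⟨ cong (q * G +_) (coeff-linear-deleteWord f u p w) ⟩
  q * G + (coeff p u * F + R)               ≡⟨ solve 4 (λ G a F R → G :+ (a :* F :+ R) := (con 0ℚ :+ a) :* F :+ (G :+ R)) refl (q * G) (coeff p u) F R ⟩
  (0ℚ + coeff p u) * F + (q * G + R)        ≡⟨ cong ((0ℚ + coeff p u) * F +_) (sym (coeff-linear-∷ f q v (deleteWord u p) w)) ⟩
  (0ℚ + coeff p u) * F + coeff (linear f ((q , v) ∷ deleteWord u p)) w ∎
  where
  F = coeff (f u) w
  G = coeff (f v) w
  R = coeff (linear f (deleteWord u p)) w

IsZero : Poly → Set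
IsZero d = ∀ w → coeff d w ≡ 0ℚ

deleteWord-IsZero : ∀ u d → IsZero d → IsZero (deleteWord u d)
deleteWord-IsZero u d d≈0 v = trans (coeff-deleteWord u d v) (helper (u ≟W v))
  where
  helper : ∀ b → (if b then 0ℚ else coeff d v) ≡ 0ℚ
  helper true = refl
  helper false = d≈0 v

linear-IsZero : ∀ f d → IsZero d → IsZero (linear f d)
linear-IsZero f d = bounded (length d) d ℕP.≤-refl
  where
  bounded : ∀ n d → length d ≤ n → IsZero d → IsZero (linear f d)
  bounded n [] _ _ w = refl
  bounded (suc n) ((q , u) ∷ d) (s≤s d≤n) d≈0 w = begin
    coeff (linear f ((q , u) ∷ d)) w
      ≡⟨ coeff-linear-deleteWord f u ((q , u) ∷ d) w ⟩
    coeff ((q , u) ∷ d) u * coeff (f u) w + coeff (linear f (deleteWord u ((q , u) ∷ d))) w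
      ≡⟨ cong₂ _+_ (trans (cong (_* coeff (f u) w) (d≈0 u)) (QP.*-zeroˡ (coeff (f u) w))) (bounded n d′ d′≤n d′≈0 w) ⟩
    0ℚ + 0ℚ
      ∎
    where
    d′ = deleteWord u ((q , u) ∷ d)
    d′≡ : d′ ≡ deleteWord u d
    d′≡ rewrite ≟W-refl u = refl
    d′≤n : length d′ ≤ n
    d′≤n rewrite d′≡ = ℕP.≤-trans (length-deleteWord u d) d≤n
    d′≈0 : IsZero d′
    d′≈0 = deleteWord-IsZero u ((q , u) ∷ d) d≈0

linear-resp-≈ : ∀ f {p r} → p ≈ r → linear f p ≈ linear f r
linear-resp-≈ f {p} {r} p≈r = ≈i λ w → difference-zero (linear-IsZero f (p ++ (- 1ℚ) · r) p-r≈0 w)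
  where
  p-r≈0 : IsZero (p ++ (- 1ℚ) · r)
  p-r≈0 v = begin
    coeff (p ++ (- 1ℚ) · r) v        ≡⟨ coeff-++ p _ v ⟩
    coeff p v + coeff ((- 1ℚ) · r) v ≡⟨ cong₂ _+_ (at p≈r v) (coeff-· (- 1ℚ) r v) ⟩
    coeff r v + - 1ℚ * coeff r v     ≡⟨ solve 1 (λ a → a :+ con (- 1ℚ) :* a := con 0ℚ) refl (coeff r v) ⟩
    0ℚ                               ∎
  difference-zero : ∀ {w} → coeff (linear f (p ++ (- 1ℚ) · r)) w ≡ 0ℚ → coeff (linear f p) w ≡ coeff (linear f r) w
  difference-zero {w} h = begin
    A                                          ≡⟨ solve 2 (λ A B → A := (A :+ con (- 1ℚ) :* B) :+ B) refl A B ⟩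
    (A + - 1ℚ * B) + B                         ≡⟨ cong (λ t → (A + t) + B) (sym (coeff-linear-· f (- 1ℚ) r w)) ⟩
    (A + coeff (linear f ((- 1ℚ) · r)) w) + B  ≡⟨ cong (_+ B) (sym (coeff-++ (linear f p) _ w)) ⟩
    coeff (linear f p ++ linear f ((- 1ℚ) · r)) w + B ≡⟨ cong (λ t → coeff t w + B) (sym (linear-++ f p _)) ⟩
    coeff (linear f (p ++ (- 1ℚ) · r)) w + B   ≡⟨ cong (_+ B) h ⟩
    0ℚ + B                                     ≡⟨ QP.+-identityˡ B ⟩
    B                                          ∎
    where
    A = coeff (linear f p) w
    B = coeff (linear f r) w

-- Defs' ℚ[_], which lives inside its module parametrised by c.
ℚ⟨_⟩ : ℕ → ℚ
ℚ⟨ k ⟩ = ℤ.+ k / 1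

ℚ⟨suc⟩ : ∀ k → ℚ⟨ suc k ⟩ ≡ ℚ⟨ k ⟩ + 1ℚ
ℚ⟨suc⟩ k = QP.toℚᵘ-injective (UP.≃-trans (UP.≃-trans (QP.toℚᵘ-fromℚᵘ (U.mkℚᵘ (ℤ.+ suc k) 0)) numerators) (UP.≃-sym addition))
  where
  open ℤSolver.+-*-Solver using () renaming (solve to ℤ-solve; _:+_ to _ℤ:+_; _:*_ to _ℤ:*_; _:=_ to _ℤ:=_; con to ℤcon)
  numerators : U.mkℚᵘ (ℤ.+ suc k) 0 U.≃ U.mkℚᵘ (ℤ.+ k) 0 U.+ U.mkℚᵘ (ℤ.+ 1) 0
  numerators = U.*≡* (ℤ-solve 1 (λ K → (ℤcon (ℤ.+ 1) ℤ:+ K) ℤ:* ℤcon (ℤ.+ 1) ℤ:= (K ℤ:* ℤcon (ℤ.+ 1) ℤ:+ ℤcon (ℤ.+ 1) ℤ:* ℤcon (ℤ.+ 1)) ℤ:* ℤcon (ℤ.+ 1)) refl (ℤ.+ k))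
  addition : toℚᵘ (ℚ⟨ k ⟩ + 1ℚ) U.≃ U.mkℚᵘ (ℤ.+ k) 0 U.+ U.mkℚᵘ (ℤ.+ 1) 0
  addition = UP.≃-trans (QP.toℚᵘ-homo-+ ℚ⟨ k ⟩ 1ℚ) (UP.+-cong (QP.toℚᵘ-fromℚᵘ (U.mkℚᵘ (ℤ.+ k) 0)) UP.≃-refl)

term⊗ : ℚ → Word → Poly → Poly
term⊗ a u r = map (λ bv → (a * proj₁ bv , u ++ proj₂ bv)) r

⊗-++ˡ : ∀ p q r → (p ++ q) ⊗ r ≡ p ⊗ r ++ q ⊗ r
⊗-++ˡ p q r = LP.concatMap-++ _ p q

⊗-[]ʳ : ∀ p → p ⊗ [] ≡ []
⊗-[]ʳ [] = refl
⊗-[]ʳ ((a , u) ∷ p) = ⊗-[]ʳ p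

coeff-⊗-⊕ˡ : ∀ p q r w → coeff ((p ⊕ q) ⊗ r) w ≡ coeff (p ⊗ r) w + coeff (q ⊗ r) w
coeff-⊗-⊕ˡ p q r w = trans (cong (λ t → coeff t w) (⊗-++ˡ p q r)) (coeff-++ (p ⊗ r) (q ⊗ r) w)

coeff-⊗-⊕ʳ : ∀ p r r′ w → coeff (p ⊗ (r ⊕ r′)) w ≡ coeff (p ⊗ r) w + coeff (p ⊗ r′) w
coeff-⊗-⊕ʳ [] r r′ w = sym (QP.+-identityˡ 0ℚ)
coeff-⊗-⊕ʳ ((a , u) ∷ p) r r′ w = begin
  coeff (term⊗ a u (r ++ r′) ++ p ⊗ (r ++ r′)) w
    ≡⟨ coeff-++ (term⊗ a u (r ++ r′)) _ w ⟩
  coeff (term⊗ a u (r ++ r′)) w + coeff (p ⊗ (r ++ r′)) w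
    ≡⟨ cong₂ _+_ (trans (cong (λ t → coeff t w) (LP.map-++ _ r r′)) (coeff-++ (term⊗ a u r) (term⊗ a u r′) w)) (coeff-⊗-⊕ʳ p r r′ w) ⟩
  (A + B) + (C + D)
    ≡⟨ solve 4 (λ A B C D → (A :+ B) :+ (C :+ D) := (A :+ C) :+ (B :+ D)) refl A B C D ⟩
  (A + C) + (B + D)
    ≡⟨ sym (cong₂ _+_ (coeff-++ (term⊗ a u r) (p ⊗ r) w) (coeff-++ (term⊗ a u r′) (p ⊗ r′) w)) ⟩
  coeff (term⊗ a u r ++ p ⊗ r) w + coeff (term⊗ a u r′ ++ p ⊗ r′) w ∎
  where
  A = coeff (term⊗ a u r) w
  B = coeff (term⊗ a u r′) w
  C = coeff (p ⊗ r) w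
  D = coeff (p ⊗ r′) w

·-term⊗ : ∀ s a u r → s · term⊗ a u r ≡ term⊗ (s * a) u r
·-term⊗ s a u r = trans (sym (LP.map-∘ r)) (LP.map-cong (λ bv → cong (_, u ++ proj₂ bv) (sym (QP.*-assoc s a (proj₁ bv)))) r)

·-++ : ∀ s p r → s · (p ++ r) ≡ s · p ++ s · r
·-++ s p r = LP.map-++ _ p r

⊗-·ˡ : ∀ s p r → (s · p) ⊗ r ≡ s · (p ⊗ r)
⊗-·ˡ s [] r = refl
⊗-·ˡ s ((a , u) ∷ p) r = trans (cong₂ _++_ (sym (·-term⊗ s a u r)) (⊗-·ˡ s p r)) (sym (·-++ s (term⊗ a u r) (p ⊗ r)))

term⊗-· : ∀ s a u r → term⊗ a u (s · r) ≡ s · term⊗ a u r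
term⊗-· s a u r = trans (sym (LP.map-∘ r)) (trans (LP.map-cong (λ bv → cong (_, u ++ proj₂ bv) (solve 3 (λ a s b → a :* (s :* b) := s :* (a :* b)) refl a s (proj₁ bv))) r) (LP.map-∘ r))

⊗-·ʳ : ∀ s p r → p ⊗ (s · r) ≡ s · (p ⊗ r)
⊗-·ʳ s [] r = refl
⊗-·ʳ s ((a , u) ∷ p) r = trans (cong₂ _++_ (term⊗-· s a u r) (⊗-·ʳ s p r)) (sym (·-++ s (term⊗ a u r) (p ⊗ r)))

coeff-⊗-·ˡ : ∀ s p r w → coeff ((s · p) ⊗ r) w ≡ s * coeff (p ⊗ r) w
coeff-⊗-·ˡ s p r w = trans (cong (λ t → coeff t w) (⊗-·ˡ s p r)) (coeff-· s (p ⊗ r) w)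

coeff-⊗-·ʳ : ∀ s p r w → coeff (p ⊗ (s · r)) w ≡ s * coeff (p ⊗ r) w
coeff-⊗-·ʳ s p r w = trans (cong (λ t → coeff t w) (⊗-·ʳ s p r)) (coeff-· s (p ⊗ r) w)

term⊗-term⊗ : ∀ a u b v r → term⊗ a u (term⊗ b v r) ≡ term⊗ (a * b) (u ++ v) r
term⊗-term⊗ a u b v r = trans (sym (LP.map-∘ r)) (LP.map-cong (λ bv → cong₂ _,_ (sym (QP.*-assoc a b (proj₁ bv))) (sym (LP.++-assoc u v (proj₂ bv)))) r)

term⊗-⊗ : ∀ a u q r → (term⊗ a u q) ⊗ r ≡ term⊗ a u (q ⊗ r)
term⊗-⊗ a u [] r = refl
term⊗-⊗ a u ((b , v) ∷ q) r = trans (cong₂ _++_ (sym (term⊗-term⊗ a u b v r)) (term⊗-⊗ a u q r)) (sym (LP.map-++ _ (term⊗ b v r) (q ⊗ r)))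

⊗-assoc : ∀ p q r → (p ⊗ q) ⊗ r ≡ p ⊗ (q ⊗ r)
⊗-assoc [] q r = refl
⊗-assoc ((a , u) ∷ p) q r = trans (⊗-++ˡ (term⊗ a u q) (p ⊗ q) r) (cong₂ _++_ (term⊗-⊗ a u q r) (⊗-assoc p q r))

term⊗-identity : ∀ r → term⊗ 1ℚ [] r ≡ r
term⊗-identity [] = refl
term⊗-identity ((b , v) ∷ r) = cong₂ _∷_ (cong (_, v) (QP.*-identityˡ b)) (term⊗-identity r)

⊗-identityˡ : ∀ p → one ⊗ p ≡ p
⊗-identityˡ p = trans (LP.++-identityʳ _) (term⊗-identity p)

⊗-identityʳ : ∀ p → p ⊗ one ≡ p
⊗-identityʳ [] = refl
⊗-identityʳ ((a , u) ∷ p) = cong₂ _∷_ (cong₂ _,_ (QP.*-identityʳ a) (LP.++-identityʳ u)) (⊗-identityʳ p)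

mon-⊗ : ∀ u v → mon u ⊗ mon v ≡ mon (u ++ v)
mon-⊗ u v = cong (λ q → (q , u ++ v) ∷ []) (QP.*-identityˡ 1ℚ)

·-mon : ∀ s u → s · mon u ≡ (s , u) ∷ []
·-mon s u = cong (λ q → (q , u) ∷ []) (QP.*-identityʳ s)

term⊗-1 : ∀ a u r → term⊗ a u r ≡ a · term⊗ 1ℚ u r
term⊗-1 a u r = trans (cong (λ s → term⊗ s u r) (sym (QP.*-identityʳ a))) (sym (·-term⊗ a 1ℚ u r))

term⊗≡·mon⊗ : ∀ a u r → term⊗ a u r ≡ a · (mon u ⊗ r)
term⊗≡·mon⊗ a u r = trans (term⊗-1 a u r) (cong (a ·_) (sym (LP.++-identityʳ (term⊗ 1ℚ u r))))

⊕-cong : ∀ {p p′ r r′} → p ≈ p′ → r ≈ r′ → p ⊕ r ≈ p′ ⊕ r′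
⊕-cong {p} {p′} {r} {r′} e f = ≈i λ w → trans (coeff-++ p r w) (trans (cong₂ _+_ (at e w) (at f w)) (sym (coeff-++ p′ r′ w)))

⊗-linearˡ : ∀ p r → p ⊗ r ≈ linear (λ u → mon u ⊗ r) p
⊗-linearˡ [] r = ≈-refl
⊗-linearˡ ((a , u) ∷ p) r = ≈i λ w → begin
  coeff (term⊗ a u r ++ p ⊗ r) w                ≡⟨ coeff-++ (term⊗ a u r) _ w ⟩
  coeff (term⊗ a u r) w + coeff (p ⊗ r) w       ≡⟨ cong₂ _+_ (trans (cong (λ t → coeff t w) (term⊗≡·mon⊗ a u r)) (coeff-· a (mon u ⊗ r) w)) (at (⊗-linearˡ p r) w) ⟩
  a * coeff (mon u ⊗ r) w + coeff (linear (λ u → mon u ⊗ r) p) w ≡⟨ sym (coeff-linear-∷ (λ u → mon u ⊗ r) a u p w) ⟩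
  coeff (linear (λ u → mon u ⊗ r) ((a , u) ∷ p)) w ∎

⊗-linearʳ : ∀ p r → p ⊗ r ≈ linear (λ v → p ⊗ mon v) r
⊗-linearʳ p [] = ≡⇒≈ (⊗-[]ʳ p)
⊗-linearʳ p ((b , v) ∷ r) = ≈i λ w → begin
  coeff (p ⊗ (((b , v) ∷ []) ++ r)) w                      ≡⟨ coeff-⊗-⊕ʳ p ((b , v) ∷ []) r w ⟩
  coeff (p ⊗ ((b , v) ∷ [])) w + coeff (p ⊗ r) w           ≡⟨ cong₂ _+_ (cong (λ t → coeff (p ⊗ t) w) (sym (·-mon b v))) (at (⊗-linearʳ p r) w) ⟩
  coeff (p ⊗ (b · mon v)) w + coeff (linear (λ v → p ⊗ mon v) r) w ≡⟨ cong (_+ coeff (linear (λ v → p ⊗ mon v) r) w) (coeff-⊗-·ʳ b p (mon v) w) ⟩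
  b * coeff (p ⊗ mon v) w + coeff (linear (λ v → p ⊗ mon v) r) w   ≡⟨ sym (coeff-linear-∷ (λ v → p ⊗ mon v) b v r w) ⟩
  coeff (linear (λ v → p ⊗ mon v) ((b , v) ∷ r)) w         ∎

⊗-congʳ : ∀ {p p′} r → p ≈ p′ → p ⊗ r ≈ p′ ⊗ r
⊗-congʳ {p} {p′} r e = ≈-trans (⊗-linearˡ p r) (≈-trans (linear-resp-≈ (λ u → mon u ⊗ r) e) (≈-sym (⊗-linearˡ p′ r)))

⊗-congˡ : ∀ p {r r′} → r ≈ r′ → p ⊗ r ≈ p ⊗ r′
⊗-congˡ p {r} {r′} e = ≈-trans (⊗-linearʳ p r) (≈-trans (linear-resp-≈ (λ v → p ⊗ mon v) e) (≈-sym (⊗-linearʳ p r′)))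

Homogeneous : ℕ → Poly → Set
Homogeneous d p = All (λ t → length (proj₂ t) ≡ d) p

Homogeneous-++ : ∀ {d p r} → Homogeneous d p → Homogeneous d r → Homogeneous d (p ++ r)
Homogeneous-++ [] hr = hr
Homogeneous-++ (h ∷ hp) hr = h ∷ Homogeneous-++ hp hr

Homogeneous-term⊗ : ∀ {d e} a u r → length u ≡ d → Homogeneous e r → Homogeneous (d ℕ.+ e) (term⊗ a u r)
Homogeneous-term⊗ a u [] eu [] = []
Homogeneous-term⊗ a u ((b , v) ∷ r) eu (h ∷ hr) = trans (LP.length-++ u) (cong₂ ℕ._+_ eu h) ∷ Homogeneous-term⊗ a u r eu hr

Homogeneous-⊗ : ∀ {d e} p r → Homogeneous d p → Homogeneous e r → Homogeneous (d ℕ.+ e) (p ⊗ r)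
Homogeneous-⊗ [] r [] hr = []
Homogeneous-⊗ ((a , u) ∷ p) r (h ∷ hp) hr = Homogeneous-++ (Homogeneous-term⊗ a u r h hr) (Homogeneous-⊗ p r hp hr)

Homogeneous-Z : Homogeneous 1 Z
Homogeneous-Z = refl ∷ refl ∷ []

Homogeneous-Y : Homogeneous 1 Y
Homogeneous-Y = refl ∷ []

Homogeneous-Z^ : ∀ j → Homogeneous j (Z ^ j)
Homogeneous-Z^ zero = refl ∷ []
Homogeneous-Z^ (suc j) = Homogeneous-⊗ Z (Z ^ j) Homogeneous-Z (Homogeneous-Z^ j)

H-homogeneous : ∀ d p → Homogeneous d p → H p ≈ ℚ⟨ d ⟩ · p
H-homogeneous d [] [] = ≈-refl
H-homogeneous d ((q , u) ∷ p) (h ∷ hp) = ≈i λ w →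
  cong₂ _+_ (cong (λ s → if u ≟W w then s else 0ℚ) (trans (cong (λ k → q * ℚ⟨ k ⟩) h) (QP.*-comm q ℚ⟨ d ⟩)))
            (at (H-homogeneous d p hp) w)

IsIndex : List ℕ → Set
IsIndex l = All (0 <_) l

Homogeneous-YZ^ : ∀ j → Homogeneous (suc j) (Y ⊗ Z ^ j)
Homogeneous-YZ^ j = Homogeneous-⊗ Y (Z ^ j) Homogeneous-Y (Homogeneous-Z^ j)

Homogeneous-wordPart : ∀ l → IsIndex l → Homogeneous (sum l) (wordPart l)
Homogeneous-wordPart [] [] = refl ∷ []
Homogeneous-wordPart (suc j ∷ l) (_ ∷ l-index) =
  Homogeneous-⊗ (Y ⊗ Z ^ j) (wordPart l) (Homogeneous-YZ^ j) (Homogeneous-wordPart l l-index)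

wordPart-⊗Y : ∀ l → wordPart l ⊗ Y ≡ wordPart (l ++ [ 1 ])
wordPart-⊗Y [] = trans (⊗-identityˡ Y) (sym (trans (⊗-identityʳ (Y ⊗ one)) (⊗-identityʳ Y)))
wordPart-⊗Y (k ∷ l) = trans (⊗-assoc (Y ⊗ Z ^ (k ∸ 1)) (wordPart l) Y) (cong ((Y ⊗ Z ^ (k ∸ 1)) ⊗_) (wordPart-⊗Y l))

Combination : Set
Combination = List (ℚ × List ℕ)

⟦_⟧ : Combination → Poly
⟦ S ⟧ = concatMap (λ ql → proj₁ ql · wordPart (proj₂ ql)) S

prepend : ℕ → Combination → Combination
prepend k S = map (λ ql → (proj₁ ql , k ∷ proj₂ ql)) S

⟦prepend⟧ : ∀ j S → ⟦ prepend (suc j) S ⟧ ≈ (Y ⊗ Z ^ j) ⊗ ⟦ S ⟧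
⟦prepend⟧ j [] = ≡⇒≈ (sym (⊗-[]ʳ (Y ⊗ Z ^ j)))
⟦prepend⟧ j ((q , l) ∷ S) = ≈i λ w → begin
  coeff (q · (P ⊗ wordPart l) ++ ⟦ prepend (suc j) S ⟧) w     ≡⟨ coeff-++ (q · (P ⊗ wordPart l)) ⟦ prepend (suc j) S ⟧ w ⟩
  coeff (q · (P ⊗ wordPart l)) w + coeff ⟦ prepend (suc j) S ⟧ w ≡⟨ cong₂ _+_ (coeff-· q (P ⊗ wordPart l) w) (at (⟦prepend⟧ j S) w) ⟩
  q * coeff (P ⊗ wordPart l) w + coeff (P ⊗ ⟦ S ⟧) w           ≡⟨ cong (_+ coeff (P ⊗ ⟦ S ⟧) w) (sym (coeff-⊗-·ʳ q P (wordPart l) w)) ⟩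
  coeff (P ⊗ (q · wordPart l)) w + coeff (P ⊗ ⟦ S ⟧) w         ≡⟨ sym (coeff-⊗-⊕ʳ P (q · wordPart l) ⟦ S ⟧ w) ⟩
  coeff (P ⊗ (q · wordPart l ++ ⟦ S ⟧)) w                      ∎
  where
  P = Y ⊗ Z ^ j

module Θ-Calculus (c : ℚ) where

  -- The index K absorbs the term c H(w) ∂₁(w′) of θ, which yields the Leibniz rule Θ-⊗.
  ΘW : ℕ → Word → Poly
  ΘW K u = θW c u ⊕ (c * ℚ⟨ K ⟩) · ∂₁W u

  Θ : ℕ → Poly → Poly
  Θ K = linear (ΘW K)

  ΘW-cons : ∀ K a r → ΘW K (a ∷ r) ≈ (mon [ a ] ⊗ Z ⊕ (c * ℚ⟨ K ⟩) · ∂₁L a) ⊗ mon r ⊕ mon [ a ] ⊗ ΘW (suc K) r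
  ΘW-cons K a r = ≈i λ w → begin
    coeff (ΘW K (a ∷ r)) w
      ≡⟨ expand-lhs w ⟩
    ((A w + B w) + c * C w) + ck * (D w + C w)
      ≡⟨ solve 6 (λ c k A B C D → ((A :+ B) :+ c :* C) :+ (c :* k) :* (D :+ C) := (A :+ (c :* k) :* D) :+ (B :+ (c :* (k :+ con 1ℚ)) :* C)) refl c ℚ⟨ K ⟩ (A w) (B w) (C w) (D w) ⟩
    (A w + ck * D w) + (B w + (c * (ℚ⟨ K ⟩ + 1ℚ)) * C w)
      ≡⟨ sym (expand-rhs w) ⟩
    coeff ((mon [ a ] ⊗ Z ⊕ ck · ∂₁L a) ⊗ mon r ⊕ mon [ a ] ⊗ ΘW (suc K) r) w ∎
    where
    ck = c * ℚ⟨ K ⟩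
    A B C D : Word → ℚ
    A = coeff (mon [ a ] ⊗ Z ⊗ mon r)
    B = coeff (mon [ a ] ⊗ θW c r)
    C = coeff (mon [ a ] ⊗ ∂₁W r)
    D = coeff (∂₁L a ⊗ mon r)
    expand-lhs : ∀ w → coeff (ΘW K (a ∷ r)) w ≡ ((A w + B w) + c * C w) + ck * (D w + C w)
    expand-lhs w =
      trans (coeff-++ (θW c (a ∷ r)) (ck · ∂₁W (a ∷ r)) w)
            (cong₂ _+_ (trans (coeff-++ (P₁ ⊕ P₂) (c · P₃) w) (cong₂ _+_ (coeff-++ P₁ P₂ w) (coeff-· c P₃ w)))
                       (trans (coeff-· ck (P₄ ⊕ P₃) w) (cong (ck *_) (coeff-++ P₄ P₃ w))))
      where
      P₁ = mon [ a ] ⊗ Z ⊗ mon r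
      P₂ = mon [ a ] ⊗ θW c r
      P₃ = mon [ a ] ⊗ ∂₁W r
      P₄ = ∂₁L a ⊗ mon r
    expand-rhs : ∀ w → coeff ((mon [ a ] ⊗ Z ⊕ ck · ∂₁L a) ⊗ mon r ⊕ mon [ a ] ⊗ ΘW (suc K) r) w
                       ≡ (A w + ck * D w) + (B w + (c * (ℚ⟨ K ⟩ + 1ℚ)) * C w)
    expand-rhs w =
      trans (coeff-++ ((mon [ a ] ⊗ Z ⊕ ck · ∂₁L a) ⊗ mon r) (mon [ a ] ⊗ ΘW (suc K) r) w)
            (cong₂ _+_ (trans (coeff-⊗-⊕ˡ (mon [ a ] ⊗ Z) (ck · ∂₁L a) (mon r) w) (cong (A w +_) (coeff-⊗-·ˡ ck (∂₁L a) (mon r) w)))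
                       (trans (coeff-⊗-⊕ʳ (mon [ a ]) (θW c r) ((c * ℚ⟨ suc K ⟩) · ∂₁W r) w)
                              (cong (B w +_) (trans (coeff-⊗-·ʳ (c * ℚ⟨ suc K ⟩) (mon [ a ]) (∂₁W r) w) (cong (λ t → c * t * C w) (ℚ⟨suc⟩ K))))))

  ΘW-++ : ∀ K u v → ΘW K (u ++ v) ≈ ΘW K u ⊗ mon v ⊕ mon u ⊗ ΘW (K ℕ.+ length u) v
  ΘW-++ K [] v = ≡⇒≈ (sym (trans (⊗-identityˡ (ΘW (K ℕ.+ 0) v)) (cong (λ k → ΘW k v) (ℕP.+-identityʳ K))))
  ΘW-++ K (a ∷ u) v =
    ≈-trans (ΘW-cons K a (u ++ v))
      (≈-trans (⊕-cong (≡⇒≈ (cong (Q ⊗_) (sym (mon-⊗ u v)))) (⊗-congˡ (mon [ a ]) (ΘW-++ (suc K) u v)))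
        (≈-trans regroup (≈-sym fold)))
    where
    ck = c * ℚ⟨ K ⟩
    Q = mon [ a ] ⊗ Z ⊕ ck · ∂₁L a
    T1 = ΘW (suc K) u
    Tv = ΘW (suc K ℕ.+ length u) v
    fold : ΘW K (a ∷ u) ⊗ mon v ⊕ mon (a ∷ u) ⊗ ΘW (K ℕ.+ length (a ∷ u)) v ≈ (Q ⊗ mon u ⊕ mon [ a ] ⊗ T1) ⊗ mon v ⊕ (mon [ a ] ⊗ mon u) ⊗ Tv
    fold = ⊕-cong (⊗-congʳ (mon v) (ΘW-cons K a u)) (≡⇒≈ (cong₂ _⊗_ (sym (mon-⊗ [ a ] u)) (cong (λ k → ΘW k v) (ℕP.+-suc K (length u)))))
    regroup : Q ⊗ (mon u ⊗ mon v) ⊕ mon [ a ] ⊗ (T1 ⊗ mon v ⊕ mon u ⊗ Tv) ≈ (Q ⊗ mon u ⊕ mon [ a ] ⊗ T1) ⊗ mon v ⊕ (mon [ a ] ⊗ mon u) ⊗ Tv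
    regroup = ≈i λ w → begin
      coeff (Q ⊗ (mon u ⊗ mon v) ⊕ mon [ a ] ⊗ (T1 ⊗ mon v ⊕ mon u ⊗ Tv)) w
        ≡⟨ trans (coeff-++ (Q ⊗ (mon u ⊗ mon v)) _ w) (cong (coeff (Q ⊗ (mon u ⊗ mon v)) w +_) (coeff-⊗-⊕ʳ (mon [ a ]) (T1 ⊗ mon v) (mon u ⊗ Tv) w)) ⟩
      coeff (Q ⊗ (mon u ⊗ mon v)) w + (coeff (mon [ a ] ⊗ (T1 ⊗ mon v)) w + coeff (mon [ a ] ⊗ (mon u ⊗ Tv)) w)
        ≡⟨ sym (cong₂ _+_ (cong (λ t → coeff t w) (⊗-assoc Q (mon u) (mon v))) (cong₂ _+_ (cong (λ t → coeff t w) (⊗-assoc (mon [ a ]) T1 (mon v))) (cong (λ t → coeff t w) (⊗-assoc (mon [ a ]) (mon u) Tv)))) ⟩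
      coeff ((Q ⊗ mon u) ⊗ mon v) w + (coeff ((mon [ a ] ⊗ T1) ⊗ mon v) w + coeff ((mon [ a ] ⊗ mon u) ⊗ Tv) w)
        ≡⟨ sym (QP.+-assoc (coeff ((Q ⊗ mon u) ⊗ mon v) w) _ _) ⟩
      (coeff ((Q ⊗ mon u) ⊗ mon v) w + coeff ((mon [ a ] ⊗ T1) ⊗ mon v) w) + coeff ((mon [ a ] ⊗ mon u) ⊗ Tv) w
        ≡⟨ sym (trans (coeff-++ ((Q ⊗ mon u ⊕ mon [ a ] ⊗ T1) ⊗ mon v) ((mon [ a ] ⊗ mon u) ⊗ Tv) w) (cong (_+ coeff ((mon [ a ] ⊗ mon u) ⊗ Tv) w) (coeff-⊗-⊕ˡ (Q ⊗ mon u) (mon [ a ] ⊗ T1) (mon v) w))) ⟩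
      coeff ((Q ⊗ mon u ⊕ mon [ a ] ⊗ T1) ⊗ mon v ⊕ (mon [ a ] ⊗ mon u) ⊗ Tv) w ∎

  Θ-term⊗ : ∀ K u r → Θ K (term⊗ 1ℚ u r) ≈ ΘW K u ⊗ r ⊕ mon u ⊗ Θ (K ℕ.+ length u) r
  Θ-term⊗ K u [] = ≡⇒≈ (sym (cong₂ _++_ (⊗-[]ʳ (ΘW K u)) (⊗-[]ʳ (mon u))))
  Θ-term⊗ K u ((b , v) ∷ r) = ≈i go
    where
    P = ΘW K u
    K′ = K ℕ.+ length u
    go : ∀ w → coeff (Θ K (term⊗ 1ℚ u ((b , v) ∷ r))) w ≡ coeff (ΘW K u ⊗ ((b , v) ∷ r) ⊕ mon u ⊗ Θ (K ℕ.+ length u) ((b , v) ∷ r)) w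
    go w = begin
      coeff (Θ K ((1ℚ * b , u ++ v) ∷ term⊗ 1ℚ u r)) w ≡⟨ coeff-linear-∷ (ΘW K) (1ℚ * b) (u ++ v) (term⊗ 1ℚ u r) w ⟩
      1ℚ * b * coeff (ΘW K (u ++ v)) w + coeff (Θ K (term⊗ 1ℚ u r)) w
        ≡⟨ cong₂ _+_ (cong (1ℚ * b *_) (trans (at (ΘW-++ K u v) w) (coeff-++ (P ⊗ mon v) (mon u ⊗ ΘW K′ v) w))) (trans (at (Θ-term⊗ K u r) w) (coeff-++ (P ⊗ r) (mon u ⊗ Θ K′ r) w)) ⟩
      1ℚ * b * (X1 + X2) + (Y1 + Y2)
        ≡⟨ solve 5 (λ b X1 X2 Y1 Y2 → con 1ℚ :* b :* (X1 :+ X2) :+ (Y1 :+ Y2) := (b :* X1 :+ Y1) :+ (b :* X2 :+ Y2)) refl b X1 X2 Y1 Y2 ⟩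
      (b * X1 + Y1) + (b * X2 + Y2)
        ≡⟨ sym (cong₂ _+_ (trans (coeff-⊗-⊕ʳ P ((b , v) ∷ []) r w) (cong (_+ Y1) (trans (cong (λ t → coeff (P ⊗ t) w) (sym (·-mon b v))) (coeff-⊗-·ʳ b P (mon v) w))))
                          (trans (coeff-⊗-⊕ʳ (mon u) (b · ΘW K′ v) (Θ K′ r) w) (cong (_+ Y2) (coeff-⊗-·ʳ b (mon u) (ΘW K′ v) w)))) ⟩
      coeff (P ⊗ ((b , v) ∷ r)) w + coeff (mon u ⊗ Θ K′ ((b , v) ∷ r)) w
        ≡⟨ sym (coeff-++ (P ⊗ ((b , v) ∷ r)) (mon u ⊗ Θ K′ ((b , v) ∷ r)) w) ⟩
      coeff (P ⊗ ((b , v) ∷ r) ⊕ mon u ⊗ Θ K′ ((b , v) ∷ r)) w ∎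
      where
      X1 = coeff (P ⊗ mon v) w
      X2 = coeff (mon u ⊗ ΘW K′ v) w
      Y1 = coeff (P ⊗ r) w
      Y2 = coeff (mon u ⊗ Θ K′ r) w

  coeff-Θ-++ : ∀ K p r w → coeff (Θ K (p ++ r)) w ≡ coeff (Θ K p) w + coeff (Θ K r) w
  coeff-Θ-++ K p r w = trans (cong (λ t → coeff t w) (linear-++ (ΘW K) p r)) (coeff-++ (Θ K p) (Θ K r) w)

  coeff-Θ-· : ∀ K s p w → coeff (Θ K (s · p)) w ≡ s * coeff (Θ K p) w
  coeff-Θ-· K s p w = coeff-linear-· (ΘW K) s p w

  Θ-⊗ : ∀ K d p r → Homogeneous d p → Θ K (p ⊗ r) ≈ Θ K p ⊗ r ⊕ p ⊗ Θ (K ℕ.+ d) r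
  Θ-⊗ K d [] r [] = ≈-refl
  Θ-⊗ K d ((s , u) ∷ p) r (|u|≡d ∷ p-hom) = ≈i λ w → begin
    coeff (Θ K (term⊗ s u r ++ p ⊗ r)) w
      ≡⟨ coeff-Θ-++ K (term⊗ s u r) (p ⊗ r) w ⟩
    coeff (Θ K (term⊗ s u r)) w + coeff (Θ K (p ⊗ r)) w
      ≡⟨ cong₂ _+_ (head-lhs w) (trans (at (Θ-⊗ K d p r p-hom) w) (coeff-++ (Θ K p ⊗ r) (p ⊗ R) w)) ⟩
    s * (A w + B w) + (C w + D w)
      ≡⟨ solve 5 (λ s A B C D → s :* (A :+ B) :+ (C :+ D) := (s :* A :+ C) :+ (s :* B :+ D)) refl s (A w) (B w) (C w) (D w) ⟩
    (s * A w + C w) + (s * B w + D w)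
      ≡⟨ sym (cong₂ _+_ (trans (coeff-⊗-⊕ˡ (s · ΘW K u) (Θ K p) r w) (cong (_+ C w) (coeff-⊗-·ˡ s (ΘW K u) r w)))
                        (trans (coeff-++ (term⊗ s u R) (p ⊗ R) w) (cong (_+ D w) (head-rhs w)))) ⟩
    coeff (Θ K ((s , u) ∷ p) ⊗ r) w + coeff (((s , u) ∷ p) ⊗ R) w
      ≡⟨ sym (coeff-++ (Θ K ((s , u) ∷ p) ⊗ r) (((s , u) ∷ p) ⊗ R) w) ⟩
    coeff (Θ K ((s , u) ∷ p) ⊗ r ⊕ ((s , u) ∷ p) ⊗ R) w ∎
    where
    R = Θ (K ℕ.+ d) r
    A B C D : Word → ℚ
    A = coeff (ΘW K u ⊗ r)
    B = coeff (mon u ⊗ R)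
    C = coeff (Θ K p ⊗ r)
    D = coeff (p ⊗ R)
    head-lhs : ∀ w → coeff (Θ K (term⊗ s u r)) w ≡ s * (A w + B w)
    head-lhs w = begin
      coeff (Θ K (term⊗ s u r)) w                ≡⟨ cong (λ t → coeff (Θ K t) w) (term⊗-1 s u r) ⟩
      coeff (Θ K (s · term⊗ 1ℚ u r)) w           ≡⟨ coeff-Θ-· K s (term⊗ 1ℚ u r) w ⟩
      s * coeff (Θ K (term⊗ 1ℚ u r)) w           ≡⟨ cong (s *_) (at (Θ-term⊗ K u r) w) ⟩
      s * coeff (ΘW K u ⊗ r ⊕ mon u ⊗ Θ (K ℕ.+ length u) r) w
        ≡⟨ cong (s *_) (coeff-++ (ΘW K u ⊗ r) (mon u ⊗ Θ (K ℕ.+ length u) r) w) ⟩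
      s * (A w + coeff (mon u ⊗ Θ (K ℕ.+ length u) r) w)
        ≡⟨ cong (λ k → s * (A w + coeff (mon u ⊗ Θ (K ℕ.+ k) r) w)) |u|≡d ⟩
      s * (A w + B w)                            ∎
    head-rhs : ∀ w → coeff (term⊗ s u R) w ≡ s * B w
    head-rhs w = trans (cong (λ t → coeff t w) (term⊗≡·mon⊗ s u R)) (coeff-· s (mon u ⊗ R) w)

  ΘW-letter : ∀ K a w → coeff (ΘW K [ a ]) w ≡ coeff (mon [ a ] ⊗ Z) w + (c * ℚ⟨ K ⟩) * coeff (∂₁L a) w
  ΘW-letter K a w = begin
    coeff (ΘW K [ a ]) w ≡⟨ at (ΘW-cons K a []) w ⟩
    coeff (Q ⊗ one ⊕ mon [ a ] ⊗ ΘW (suc K) []) w ≡⟨ coeff-++ (Q ⊗ one) (mon [ a ] ⊗ ΘW (suc K) []) w ⟩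
    coeff (Q ⊗ one) w + coeff (mon [ a ] ⊗ []) w ≡⟨ cong₂ _+_ (cong (λ t → coeff t w) (⊗-identityʳ Q)) (cong (λ t → coeff t w) (⊗-[]ʳ (mon [ a ]))) ⟩
    coeff Q w + 0ℚ ≡⟨ QP.+-identityʳ (coeff Q w) ⟩
    coeff Q w ≡⟨ coeff-++ (mon [ a ] ⊗ Z) ((c * ℚ⟨ K ⟩) · ∂₁L a) w ⟩
    coeff (mon [ a ] ⊗ Z) w + coeff ((c * ℚ⟨ K ⟩) · ∂₁L a) w ≡⟨ cong (coeff (mon [ a ] ⊗ Z) w +_) (coeff-· (c * ℚ⟨ K ⟩) (∂₁L a) w) ⟩
    coeff (mon [ a ] ⊗ Z) w + (c * ℚ⟨ K ⟩) * coeff (∂₁L a) w ∎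
    where Q = mon [ a ] ⊗ Z ⊕ (c * ℚ⟨ K ⟩) · ∂₁L a

  Θ-Z : ∀ K → Θ K Z ≈ Z ⊗ Z
  Θ-Z K = ≈i λ w →
    let
      k = c * ℚ⟨ K ⟩
      A = coeff (X ⊗ Z) w
      B = coeff (Y ⊗ Z) w
      D = coeff (Y ⊗ X) w
    in begin
      coeff (Θ K Z) w ≡⟨ coeff-linear-∷ (ΘW K) 1ℚ [ x ] ((1ℚ , [ y ]) ∷ []) w ⟩
      1ℚ * coeff (ΘW K [ x ]) w + coeff (Θ K ((1ℚ , [ y ]) ∷ [])) w ≡⟨ cong (1ℚ * coeff (ΘW K [ x ]) w +_) (coeff-linear-∷ (ΘW K) 1ℚ [ y ] [] w) ⟩
      1ℚ * coeff (ΘW K [ x ]) w + (1ℚ * coeff (ΘW K [ y ]) w + 0ℚ) ≡⟨ cong₂ (λ s t → 1ℚ * s + (1ℚ * t + 0ℚ)) (ΘW-letter K x w) (trans (ΘW-letter K y w) (cong (λ t → coeff (Y ⊗ Z) w + (c * ℚ⟨ K ⟩) * t) (coeff-· (- 1ℚ) (Y ⊗ X) w))) ⟩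
      1ℚ * (A + k * D) + (1ℚ * (B + k * (- 1ℚ * D)) + 0ℚ) ≡⟨ solve 4 (λ A B D k → con 1ℚ :* (A :+ k :* D) :+ (con 1ℚ :* (B :+ k :* (con (- 1ℚ) :* D)) :+ con 0ℚ) := A :+ B) refl A B D k ⟩
      A + B ≡⟨ sym (coeff-⊗-⊕ˡ X Y Z w) ⟩
      coeff (Z ⊗ Z) w ∎

  Θ-Z^ : ∀ K j → Θ K (Z ^ j) ≈ ℚ⟨ j ⟩ · (Z ^ suc j)
  Θ-Z^ K zero = ≈i λ w → sym (trans (coeff-· 0ℚ (Z ^ 1) w) (QP.*-zeroˡ (coeff (Z ^ 1) w)))
  Θ-Z^ K (suc j) = ≈i λ w →
    let
      C = coeff (Z ^ suc (suc j)) w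
    in begin
      coeff (Θ K (Z ⊗ Z ^ j)) w ≡⟨ at (Θ-⊗ K 1 Z (Z ^ j) Homogeneous-Z) w ⟩
      coeff (Θ K Z ⊗ Z ^ j ⊕ Z ⊗ Θ (K ℕ.+ 1) (Z ^ j)) w ≡⟨ coeff-++ (Θ K Z ⊗ Z ^ j) (Z ⊗ Θ (K ℕ.+ 1) (Z ^ j)) w ⟩
      coeff (Θ K Z ⊗ Z ^ j) w + coeff (Z ⊗ Θ (K ℕ.+ 1) (Z ^ j)) w
        ≡⟨ cong₂ _+_ (trans (at (⊗-congʳ (Z ^ j) (Θ-Z K)) w) (cong (λ t → coeff t w) (⊗-assoc Z Z (Z ^ j))))
                     (trans (at (⊗-congˡ Z (Θ-Z^ (K ℕ.+ 1) j)) w) (coeff-⊗-·ʳ ℚ⟨ j ⟩ Z (Z ^ suc j) w)) ⟩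
      C + ℚ⟨ j ⟩ * C ≡⟨ solve 2 (λ C q → C :+ q :* C := (q :+ con 1ℚ) :* C) refl C ℚ⟨ j ⟩ ⟩
      (ℚ⟨ j ⟩ + 1ℚ) * C ≡⟨ cong (_* C) (sym (ℚ⟨suc⟩ j)) ⟩
      ℚ⟨ suc j ⟩ * C ≡⟨ sym (coeff-· ℚ⟨ suc j ⟩ (Z ^ suc (suc j)) w) ⟩
      coeff (ℚ⟨ suc j ⟩ · (Z ^ suc (suc j))) w ∎

  Θ-Y : ∀ K → Θ K Y ≈ (1ℚ - c * ℚ⟨ K ⟩) · (Y ⊗ Z) ⊕ (c * ℚ⟨ K ⟩) · (Y ⊗ Y)
  Θ-Y K = ≈i λ w →
    let
      k = c * ℚ⟨ K ⟩
      A = coeff (Y ⊗ X) w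
      B = coeff (Y ⊗ Y) w
    in begin
      coeff (Θ K Y) w ≡⟨ coeff-linear-∷ (ΘW K) 1ℚ [ y ] [] w ⟩
      1ℚ * coeff (ΘW K [ y ]) w + 0ℚ ≡⟨ cong (λ t → 1ℚ * t + 0ℚ) (trans (ΘW-letter K y w) (cong₂ (λ s t → s + k * t) (coeff-⊗-⊕ʳ Y X Y w) (coeff-· (- 1ℚ) (Y ⊗ X) w))) ⟩
      1ℚ * ((A + B) + k * (- 1ℚ * A)) + 0ℚ ≡⟨ solve 3 (λ A B k → con 1ℚ :* ((A :+ B) :+ k :* (con (- 1ℚ) :* A)) :+ con 0ℚ := (con 1ℚ :- k) :* (A :+ B) :+ k :* B) refl A B k ⟩
      (1ℚ - k) * (A + B) + k * B ≡⟨ cong (λ t → (1ℚ - k) * t + k * B) (sym (coeff-⊗-⊕ʳ Y X Y w)) ⟩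
      (1ℚ - k) * coeff (Y ⊗ Z) w + k * B ≡⟨ sym (coeff-·⊕· (1ℚ - k) (Y ⊗ Z) k (Y ⊗ Y) w) ⟩
      coeff ((1ℚ - k) · (Y ⊗ Z) ⊕ k · (Y ⊗ Y)) w ∎

  Θ-YZ^ : ∀ K j → Θ K (Y ⊗ Z ^ j) ≈ (ℚ⟨ suc j ⟩ - c * ℚ⟨ K ⟩) · (Y ⊗ Z ^ suc j) ⊕ (c * ℚ⟨ K ⟩) · ((Y ⊗ Y) ⊗ Z ^ j)
  Θ-YZ^ K j = ≈i λ w →
    let
      k = c * ℚ⟨ K ⟩
      P = coeff (Y ⊗ Z ^ suc j) w
      Q = coeff ((Y ⊗ Y) ⊗ Z ^ j) w
    in begin
      coeff (Θ K (Y ⊗ Z ^ j)) w ≡⟨ at (Θ-⊗ K 1 Y (Z ^ j) Homogeneous-Y) w ⟩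
      coeff (Θ K Y ⊗ Z ^ j ⊕ Y ⊗ Θ (K ℕ.+ 1) (Z ^ j)) w ≡⟨ coeff-++ (Θ K Y ⊗ Z ^ j) (Y ⊗ Θ (K ℕ.+ 1) (Z ^ j)) w ⟩
      coeff (Θ K Y ⊗ Z ^ j) w + coeff (Y ⊗ Θ (K ℕ.+ 1) (Z ^ j)) w
        ≡⟨ cong₂ _+_ (trans (at (⊗-congʳ (Z ^ j) (Θ-Y K)) w)
                        (trans (coeff-⊗-⊕ˡ ((1ℚ - k) · (Y ⊗ Z)) (k · (Y ⊗ Y)) (Z ^ j) w)
                           (cong₂ _+_ (trans (coeff-⊗-·ˡ (1ℚ - k) (Y ⊗ Z) (Z ^ j) w) (cong (λ t → (1ℚ - k) * coeff t w) (⊗-assoc Y Z (Z ^ j))))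
                                      (coeff-⊗-·ˡ k (Y ⊗ Y) (Z ^ j) w))))
                     (trans (at (⊗-congˡ Y (Θ-Z^ (K ℕ.+ 1) j)) w) (coeff-⊗-·ʳ ℚ⟨ j ⟩ Y (Z ^ suc j) w)) ⟩
      ((1ℚ - k) * P + k * Q) + ℚ⟨ j ⟩ * P ≡⟨ solve 4 (λ k P Q q → ((con 1ℚ :- k) :* P :+ k :* Q) :+ q :* P := ((q :+ con 1ℚ) :- k) :* P :+ k :* Q) refl k P Q ℚ⟨ j ⟩ ⟩
      ((ℚ⟨ j ⟩ + 1ℚ) - k) * P + k * Q ≡⟨ cong (λ t → (t - k) * P + k * Q) (sym (ℚ⟨suc⟩ j)) ⟩
      (ℚ⟨ suc j ⟩ - k) * P + k * Q ≡⟨ sym (coeff-·⊕· (ℚ⟨ suc j ⟩ - k) (Y ⊗ Z ^ suc j) k ((Y ⊗ Y) ⊗ Z ^ j) w) ⟩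
      coeff ((ℚ⟨ suc j ⟩ - k) · (Y ⊗ Z ^ suc j) ⊕ k · ((Y ⊗ Y) ⊗ Z ^ j)) w ∎



  Θ-wordPart : ∀ K j l →
    Θ K (wordPart (suc j ∷ l)) ≈ (ℚ⟨ suc j ⟩ - c * ℚ⟨ K ⟩) · wordPart (suc (suc j) ∷ l)
                                ⊕ (c * ℚ⟨ K ⟩) · wordPart (1 ∷ suc j ∷ l)
                                ⊕ (Y ⊗ Z ^ j) ⊗ Θ (K ℕ.+ suc j) (wordPart l)
  Θ-wordPart K j l = ≈i λ w → begin
    coeff (Θ K ((Y ⊗ Z ^ j) ⊗ W)) w
      ≡⟨ at (Θ-⊗ K (suc j) (Y ⊗ Z ^ j) W (Homogeneous-YZ^ j)) w ⟩
    coeff (Θ K (Y ⊗ Z ^ j) ⊗ W ⊕ T) w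
      ≡⟨ coeff-++ (Θ K (Y ⊗ Z ^ j) ⊗ W) T w ⟩
    coeff (Θ K (Y ⊗ Z ^ j) ⊗ W) w + coeff T w
      ≡⟨ cong (_+ coeff T w) (at (⊗-congʳ W (Θ-YZ^ K j)) w) ⟩
    coeff ((α · (Y ⊗ Z ^ suc j) ⊕ k · ((Y ⊗ Y) ⊗ Z ^ j)) ⊗ W) w + coeff T w
      ≡⟨ cong (_+ coeff T w) (coeff-⊗-⊕ˡ (α · (Y ⊗ Z ^ suc j)) (k · ((Y ⊗ Y) ⊗ Z ^ j)) W w) ⟩
    (coeff ((α · (Y ⊗ Z ^ suc j)) ⊗ W) w + coeff ((k · ((Y ⊗ Y) ⊗ Z ^ j)) ⊗ W) w) + coeff T w
      ≡⟨ cong (_+ coeff T w) (cong₂ _+_ (coeff-⊗-·ˡ α (Y ⊗ Z ^ suc j) W w)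
                                         (trans (coeff-⊗-·ˡ k ((Y ⊗ Y) ⊗ Z ^ j) W w) (cong (λ t → k * coeff t w) split-first-y))) ⟩
    (α * coeff (wordPart (suc (suc j) ∷ l)) w + k * coeff (wordPart (1 ∷ suc j ∷ l)) w) + coeff T w
      ≡⟨ cong (_+ coeff T w) (sym (coeff-·⊕· α (wordPart (suc (suc j) ∷ l)) k (wordPart (1 ∷ suc j ∷ l)) w)) ⟩
    coeff (α · wordPart (suc (suc j) ∷ l) ⊕ k · wordPart (1 ∷ suc j ∷ l)) w + coeff T w
      ≡⟨ sym (coeff-++ (α · wordPart (suc (suc j) ∷ l) ⊕ k · wordPart (1 ∷ suc j ∷ l)) T w) ⟩
    coeff (α · wordPart (suc (suc j) ∷ l) ⊕ k · wordPart (1 ∷ suc j ∷ l) ⊕ T) w ∎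
    where
    k = c * ℚ⟨ K ⟩
    α = ℚ⟨ suc j ⟩ - k
    W = wordPart l
    T = (Y ⊗ Z ^ j) ⊗ Θ (K ℕ.+ suc j) W
    split-first-y : ((Y ⊗ Y) ⊗ Z ^ j) ⊗ W ≡ wordPart (1 ∷ suc j ∷ l)
    split-first-y = begin
      ((Y ⊗ Y) ⊗ Z ^ j) ⊗ W ≡⟨ ⊗-assoc (Y ⊗ Y) (Z ^ j) W ⟩
      (Y ⊗ Y) ⊗ (Z ^ j ⊗ W) ≡⟨ ⊗-assoc Y Y (Z ^ j ⊗ W) ⟩
      Y ⊗ (Y ⊗ (Z ^ j ⊗ W)) ≡⟨ cong (Y ⊗_) (sym (⊗-assoc Y (Z ^ j) W)) ⟩
      Y ⊗ ((Y ⊗ Z ^ j) ⊗ W) ≡⟨ cong (_⊗ ((Y ⊗ Z ^ j) ⊗ W)) (sym (⊗-identityʳ Y)) ⟩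
      (Y ⊗ one) ⊗ ((Y ⊗ Z ^ j) ⊗ W) ∎

  expansion : ℕ → List ℕ → Combination
  expansion K [] = (c * ℚ⟨ K ⟩ , 1 ∷ []) ∷ []
  expansion K (k ∷ l) =
    (ℚ⟨ k ⟩ - c * ℚ⟨ K ⟩ , suc k ∷ l) ∷ (c * ℚ⟨ K ⟩ , 1 ∷ k ∷ l) ∷ prepend k (expansion (K ℕ.+ k) l)

  ⟦expansion⟧ : ∀ K l → IsIndex l → ⟦ expansion K l ⟧ ≈ Θ K (wordPart l) ⊕ (c * ℚ⟨ K ℕ.+ sum l ⟩) · wordPart (l ++ [ 1 ])
  ⟦expansion⟧ K [] [] = ≈i λ w → begin
    coeff ((c * ℚ⟨ K ⟩) · Y₁ ++ []) w          ≡⟨ coeff-++ ((c * ℚ⟨ K ⟩) · Y₁) [] w ⟩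
    coeff ((c * ℚ⟨ K ⟩) · Y₁) w + 0ℚ           ≡⟨ QP.+-comm (coeff ((c * ℚ⟨ K ⟩) · Y₁) w) 0ℚ ⟩
    0ℚ + coeff ((c * ℚ⟨ K ⟩) · Y₁) w           ≡⟨ cong (λ k → 0ℚ + coeff ((c * ℚ⟨ k ⟩) · Y₁) w) (sym (ℕP.+-identityʳ K)) ⟩
    0ℚ + coeff ((c * ℚ⟨ K ℕ.+ 0 ⟩) · Y₁) w     ≡⟨ sym (coeff-++ (Θ K one) ((c * ℚ⟨ K ℕ.+ 0 ⟩) · Y₁) w) ⟩
    coeff (Θ K one ⊕ (c * ℚ⟨ K ℕ.+ 0 ⟩) · Y₁) w ∎
    where
    Y₁ = wordPart [ 1 ]
  ⟦expansion⟧ K (suc j ∷ l) (_ ∷ l-index) = ≈i λ w → begin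
    coeff (α · A₁ ++ (k · A₂ ++ R)) w
      ≡⟨ trans (coeff-++ (α · A₁) (k · A₂ ++ R) w) (cong₂ _+_ (coeff-· α A₁ w) (trans (coeff-++ (k · A₂) R w) (cong (_+ coeff R w) (coeff-· k A₂ w)))) ⟩
    α * coeff A₁ w + (k * coeff A₂ w + coeff R w)
      ≡⟨ cong (λ t → α * coeff A₁ w + (k * coeff A₂ w + t)) (tail w) ⟩
    α * coeff A₁ w + (k * coeff A₂ w + (coeff T w + β * coeff U w))
      ≡⟨ solve 5 (λ a b t d u → a :+ (b :+ (t :+ d :* u)) := ((a :+ b) :+ t) :+ d :* u) refl (α * coeff A₁ w) (k * coeff A₂ w) (coeff T w) β (coeff U w) ⟩
    ((α * coeff A₁ w + k * coeff A₂ w) + coeff T w) + β * coeff U w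
      ≡⟨ cong (λ t → (t + coeff T w) + β * coeff U w) (sym (coeff-·⊕· α A₁ k A₂ w)) ⟩
    (coeff (α · A₁ ⊕ k · A₂) w + coeff T w) + β * coeff U w
      ≡⟨ cong₂ _+_ (sym (trans (at (Θ-wordPart K j l) w) (coeff-++ (α · A₁ ⊕ k · A₂) T w))) (sym (coeff-· β U w)) ⟩
    coeff (Θ K (wordPart (suc j ∷ l))) w + coeff (β · U) w
      ≡⟨ sym (coeff-++ (Θ K (wordPart (suc j ∷ l))) (β · U) w) ⟩
    coeff (Θ K (wordPart (suc j ∷ l)) ⊕ β · U) w ∎
    where
    k = c * ℚ⟨ K ⟩
    α = ℚ⟨ suc j ⟩ - k
    K′ = K ℕ.+ suc j
    β = c * ℚ⟨ K ℕ.+ (suc j ℕ.+ sum l) ⟩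
    P = Y ⊗ Z ^ j
    A₁ = wordPart (suc (suc j) ∷ l)
    A₂ = wordPart (1 ∷ suc j ∷ l)
    R = ⟦ prepend (suc j) (expansion K′ l) ⟧
    T = P ⊗ Θ K′ (wordPart l)
    U = P ⊗ wordPart (l ++ [ 1 ])
    tail : ∀ w → coeff R w ≡ coeff T w + β * coeff U w
    tail w = begin
      coeff R w
        ≡⟨ at (⟦prepend⟧ j (expansion K′ l)) w ⟩
      coeff (P ⊗ ⟦ expansion K′ l ⟧) w
        ≡⟨ at (⊗-congˡ P (⟦expansion⟧ K′ l l-index)) w ⟩
      coeff (P ⊗ (Θ K′ (wordPart l) ⊕ (c * ℚ⟨ K′ ℕ.+ sum l ⟩) · wordPart (l ++ [ 1 ]))) w
        ≡⟨ coeff-⊗-⊕ʳ P (Θ K′ (wordPart l)) _ w ⟩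
      coeff T w + coeff (P ⊗ ((c * ℚ⟨ K′ ℕ.+ sum l ⟩) · wordPart (l ++ [ 1 ]))) w
        ≡⟨ cong (coeff T w +_) (coeff-⊗-·ʳ (c * ℚ⟨ K′ ℕ.+ sum l ⟩) P (wordPart (l ++ [ 1 ])) w) ⟩
      coeff T w + c * ℚ⟨ K′ ℕ.+ sum l ⟩ * coeff U w
        ≡⟨ cong (λ n → coeff T w + c * ℚ⟨ n ⟩ * coeff U w) (ℕP.+-assoc K (suc j) (sum l)) ⟩
      coeff T w + β * coeff U w ∎

  θ̃W : Word → Poly
  θ̃W u = θW c u ⊕ (c * ℚ⟨ length u ⟩) · (mon u ⊗ Y)

  θ̃-linear : ∀ p → θ̃ c p ≈ linear θ̃W p
  θ̃-linear [] = ≈-refl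
  θ̃-linear ((s , u) ∷ p) = ≈i λ w → begin
    coeff (θ̃ c ((s , u) ∷ p)) w
      ≡⟨ coeff-++ (θ c ((s , u) ∷ p)) (c · (H ((s , u) ∷ p) ⊗ Y)) w ⟩
    coeff (θ c ((s , u) ∷ p)) w + coeff (c · (H ((s , u) ∷ p) ⊗ Y)) w
      ≡⟨ cong₂ _+_ (θ-part w) (trans (coeff-· c (H ((s , u) ∷ p) ⊗ Y) w) (cong (c *_) (H-part w))) ⟩
    (s * A w + C w) + c * ((s * n) * B w + D w)
      ≡⟨ solve 7 (λ s A C c n B D → (s :* A :+ C) :+ c :* ((s :* n) :* B :+ D) := s :* (A :+ (c :* n) :* B) :+ (C :+ c :* D)) refl s (A w) (C w) c n (B w) (D w) ⟩
    s * (A w + (c * n) * B w) + (C w + c * D w)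
      ≡⟨ sym (cong₂ _+_ (cong (s *_) (θ̃W-part w)) (tail-part w)) ⟩
    s * coeff (θ̃W u) w + coeff (linear θ̃W p) w
      ≡⟨ sym (coeff-linear-∷ θ̃W s u p w) ⟩
    coeff (linear θ̃W ((s , u) ∷ p)) w ∎
    where
    n = ℚ⟨ length u ⟩
    A B C D : Word → ℚ
    A = coeff (θW c u)
    B = coeff (mon u ⊗ Y)
    C = coeff (θ c p)
    D = coeff (H p ⊗ Y)
    θ-part : ∀ w → coeff (θ c ((s , u) ∷ p)) w ≡ s * A w + C w
    θ-part = coeff-linear-∷ (θW c) s u p
    H-part : ∀ w → coeff (H ((s , u) ∷ p) ⊗ Y) w ≡ (s * n) * B w + D w
    H-part w = trans (coeff-++ (term⊗ (s * n) u Y) (H p ⊗ Y) w)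
                     (cong (_+ D w) (trans (cong (λ t → coeff t w) (term⊗≡·mon⊗ (s * n) u Y)) (coeff-· (s * n) (mon u ⊗ Y) w)))
    θ̃W-part : ∀ w → coeff (θ̃W u) w ≡ A w + (c * n) * B w
    θ̃W-part w = trans (coeff-++ (θW c u) ((c * n) · (mon u ⊗ Y)) w) (cong (A w +_) (coeff-· (c * n) (mon u ⊗ Y) w))
    tail-part : ∀ w → coeff (linear θ̃W p) w ≡ C w + c * D w
    tail-part w = trans (sym (at (θ̃-linear p) w))
                        (trans (coeff-++ (θ c p) (c · (H p ⊗ Y)) w) (cong (C w +_) (coeff-· c (H p ⊗ Y) w)))

  θ̃-resp-≈ : ∀ {p r} → p ≈ r → θ̃ c p ≈ θ̃ c r
  θ̃-resp-≈ {p} {r} e = ≈-trans (θ̃-linear p) (≈-trans (linear-resp-≈ θ̃W e) (≈-sym (θ̃-linear r)))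

  coeff-θ̃-++ : ∀ p r w → coeff (θ̃ c (p ++ r)) w ≡ coeff (θ̃ c p) w + coeff (θ̃ c r) w
  coeff-θ̃-++ p r w = begin
    coeff (θ̃ c (p ++ r)) w                          ≡⟨ at (θ̃-linear (p ++ r)) w ⟩
    coeff (linear θ̃W (p ++ r)) w                    ≡⟨ cong (λ t → coeff t w) (linear-++ θ̃W p r) ⟩
    coeff (linear θ̃W p ++ linear θ̃W r) w            ≡⟨ coeff-++ (linear θ̃W p) (linear θ̃W r) w ⟩
    coeff (linear θ̃W p) w + coeff (linear θ̃W r) w   ≡⟨ sym (cong₂ _+_ (at (θ̃-linear p) w) (at (θ̃-linear r) w)) ⟩
    coeff (θ̃ c p) w + coeff (θ̃ c r) w               ∎

  coeff-θ̃-· : ∀ s p w → coeff (θ̃ c (s · p)) w ≡ s * coeff (θ̃ c p) w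
  coeff-θ̃-· s p w = trans (at (θ̃-linear (s · p)) w) (trans (coeff-linear-· θ̃W s p w) (cong (s *_) (sym (at (θ̃-linear p) w))))

  θ≈Θ₀ : ∀ p → θ c p ≈ Θ 0 p
  θ≈Θ₀ = linear-cong λ u → ≈i λ w → begin
    coeff (θW c u) w                              ≡⟨ solve 3 (λ A c B → A := A :+ (c :* con 0ℚ) :* B) refl (coeff (θW c u) w) c (coeff (∂₁W u) w) ⟩
    coeff (θW c u) w + (c * 0ℚ) * coeff (∂₁W u) w ≡⟨ sym (cong (coeff (θW c u) w +_) (coeff-· (c * 0ℚ) (∂₁W u) w)) ⟩
    coeff (θW c u) w + coeff ((c * 0ℚ) · ∂₁W u) w ≡⟨ sym (coeff-++ (θW c u) ((c * 0ℚ) · ∂₁W u) w) ⟩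
    coeff (ΘW 0 u) w                              ∎

  θ̃-wordPart : ∀ l → IsIndex l → θ̃ c (wordPart l) ≈ ⟦ expansion 0 l ⟧
  θ̃-wordPart l l-index = ≈-trans (⊕-cong (θ≈Θ₀ (wordPart l)) Hpart) (≈-sym (⟦expansion⟧ 0 l l-index))
    where
    Hpart : c · (H (wordPart l) ⊗ Y) ≈ (c * ℚ⟨ sum l ⟩) · wordPart (l ++ [ 1 ])
    Hpart = ≈i λ w → begin
      coeff (c · (H (wordPart l) ⊗ Y)) w
        ≡⟨ coeff-· c (H (wordPart l) ⊗ Y) w ⟩
      c * coeff (H (wordPart l) ⊗ Y) w
        ≡⟨ cong (c *_) (at (⊗-congʳ Y (H-homogeneous (sum l) (wordPart l) (Homogeneous-wordPart l l-index))) w) ⟩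
      c * coeff ((ℚ⟨ sum l ⟩ · wordPart l) ⊗ Y) w
        ≡⟨ cong (c *_) (coeff-⊗-·ˡ ℚ⟨ sum l ⟩ (wordPart l) Y w) ⟩
      c * (ℚ⟨ sum l ⟩ * coeff (wordPart l ⊗ Y) w)
        ≡⟨ cong (λ t → c * (ℚ⟨ sum l ⟩ * coeff t w)) (wordPart-⊗Y l) ⟩
      c * (ℚ⟨ sum l ⟩ * coeff (wordPart (l ++ [ 1 ])) w)
        ≡⟨ sym (QP.*-assoc c ℚ⟨ sum l ⟩ (coeff (wordPart (l ++ [ 1 ])) w)) ⟩
      (c * ℚ⟨ sum l ⟩) * coeff (wordPart (l ++ [ 1 ])) w
        ≡⟨ sym (coeff-· (c * ℚ⟨ sum l ⟩) (wordPart (l ++ [ 1 ])) w) ⟩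
      coeff ((c * ℚ⟨ sum l ⟩) · wordPart (l ++ [ 1 ])) w ∎

sumOver : ∀ {A : Set} → List A → (A → ℚ) → ℚ
sumOver [] g = 0ℚ
sumOver (a ∷ as) g = g a + sumOver as g

sumOver-++ : ∀ {A : Set} (L M : List A) g → sumOver (L ++ M) g ≡ sumOver L g + sumOver M g
sumOver-++ [] M g = sym (QP.+-identityˡ (sumOver M g))
sumOver-++ (a ∷ L) M g = trans (cong (g a +_) (sumOver-++ L M g)) (sym (QP.+-assoc (g a) (sumOver L g) (sumOver M g)))

sumOver-map : ∀ {A B : Set} (f : A → B) L g → sumOver (map f L) g ≡ sumOver L (λ x → g (f x))
sumOver-map f [] g = refl
sumOver-map f (a ∷ L) g = cong (g (f a) +_) (sumOver-map f L g)

sumOver-concatMap : ∀ {A B : Set} (h : A → List B) L g → sumOver (concatMap h L) g ≡ sumOver L (λ x → sumOver (h x) g)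
sumOver-concatMap h [] g = refl
sumOver-concatMap h (a ∷ L) g = trans (sumOver-++ (h a) (concatMap h L) g) (cong (sumOver (h a) g +_) (sumOver-concatMap h L g))

sumOver-cong : ∀ {A : Set} L {f g : A → ℚ} → (∀ x → f x ≡ g x) → sumOver L f ≡ sumOver L g
sumOver-cong [] e = refl
sumOver-cong (a ∷ L) e = cong₂ _+_ (e a) (sumOver-cong L e)

sumOver-cong-All : ∀ {A : Set} {P : A → Set} {L f g} → All P L → (∀ x → P x → f x ≡ g x) → sumOver L f ≡ sumOver L g
sumOver-cong-All [] e = refl
sumOver-cong-All (p ∷ ps) e = cong₂ _+_ (e _ p) (sumOver-cong-All ps e)

sumOver-+ : ∀ {A : Set} L (f g : A → ℚ) → sumOver L (λ x → f x + g x) ≡ sumOver L f + sumOver L g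
sumOver-+ [] f g = sym (QP.+-identityˡ 0ℚ)
sumOver-+ (a ∷ L) f g = trans (cong (f a + g a +_) (sumOver-+ L f g)) (solve 4 (λ A B C D → A :+ B :+ (C :+ D) := A :+ C :+ (B :+ D)) refl (f a) (g a) (sumOver L f) (sumOver L g))

sumOver-* : ∀ {A : Set} L s (f : A → ℚ) → sumOver L (λ x → s * f x) ≡ s * sumOver L f
sumOver-* [] s f = sym (QP.*-zeroʳ s)
sumOver-* (a ∷ L) s f = trans (cong (s * f a +_) (sumOver-* L s f)) (sym (QP.*-distribˡ-+ s (f a) (sumOver L f)))

sumFin : ∀ n → (Fin n → ℚ) → ℚ
sumFin zero g = 0ℚ
sumFin (suc n) g = g fzero + sumFin n (λ i → g (fsuc i))

sumUpTo : ℕ → (ℕ → ℚ) → ℚ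
sumUpTo zero g = 0ℚ
sumUpTo (suc n) g = g 0 + sumUpTo n (λ i → g (suc i))

sumOver-tabulate : ∀ {A : Set} n (e : Fin n → A) g → sumOver (tabulate e) g ≡ sumFin n (λ i → g (e i))
sumOver-tabulate zero e g = refl
sumOver-tabulate (suc n) e g = cong (g (e fzero) +_) (sumOver-tabulate n (λ i → e (fsuc i)) g)

sumFin-cong : ∀ n {f g : Fin n → ℚ} → (∀ i → f i ≡ g i) → sumFin n f ≡ sumFin n g
sumFin-cong zero e = refl
sumFin-cong (suc n) e = cong₂ _+_ (e fzero) (sumFin-cong n (λ i → e (fsuc i)))

sumFin-toℕ : ∀ n (h : ℕ → ℚ) → sumFin n (λ i → h (toℕ i)) ≡ sumUpTo n h
sumFin-toℕ zero h = refl
sumFin-toℕ (suc n) h = cong (h 0 +_) (sumFin-toℕ n (λ i → h (suc i)))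

sumUpTo-* : ∀ n s h → sumUpTo n (λ i → s * h i) ≡ s * sumUpTo n h
sumUpTo-* zero s h = sym (QP.*-zeroʳ s)
sumUpTo-* (suc n) s h = trans (cong (s * h 0 +_) (sumUpTo-* n s (λ i → h (suc i)))) (sym (QP.*-distribˡ-+ s (h 0) (sumUpTo n (λ i → h (suc i)))))

sumUpTo-cong : ∀ n {f g : ℕ → ℚ} → (∀ i → f i ≡ g i) → sumUpTo n f ≡ sumUpTo n g
sumUpTo-cong zero e = refl
sumUpTo-cong (suc n) e = cong₂ _+_ (e 0) (sumUpTo-cong n (λ i → e (suc i)))

sumSplits : ℕ → (ℕ → ℕ → ℚ) → ℚ
sumSplits zero g = g 0 0
sumSplits (suc n) g = g 0 (suc n) + sumSplits n (λ k j → g (suc k) j)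

sumSplits-cong : ∀ n {g h : ℕ → ℕ → ℚ} → (∀ k j → k ℕ.+ j ≡ n → g k j ≡ h k j) → sumSplits n g ≡ sumSplits n h
sumSplits-cong zero e = e 0 0 refl
sumSplits-cong (suc n) e = cong₂ _+_ (e 0 (suc n) refl) (sumSplits-cong n (λ k j eq → e (suc k) j (cong suc eq)))

sumSplits-+ : ∀ n (g h : ℕ → ℕ → ℚ) → sumSplits n (λ k j → g k j + h k j) ≡ sumSplits n g + sumSplits n h
sumSplits-+ zero g h = refl
sumSplits-+ (suc n) g h = trans (cong (g 0 (suc n) + h 0 (suc n) +_) (sumSplits-+ n (λ k j → g (suc k) j) (λ k j → h (suc k) j)))
  (solve 4 (λ A B C D → A :+ B :+ (C :+ D) := A :+ C :+ (B :+ D)) refl (g 0 (suc n)) (h 0 (suc n)) (sumSplits n (λ k j → g (suc k) j)) (sumSplits n (λ k j → h (suc k) j)))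

sumSplits-last : ∀ n (g : ℕ → ℕ → ℚ) → sumSplits (suc n) g ≡ sumSplits n (λ k j → g k (suc j)) + g (suc n) 0
sumSplits-last zero g = refl
sumSplits-last (suc n) g = trans (cong (g 0 (suc (suc n)) +_) (sumSplits-last n (λ k j → g (suc k) j)))
  (sym (QP.+-assoc (g 0 (suc (suc n))) (sumSplits n (λ k j → g (suc k) (suc j))) (g (suc (suc n)) 0)))

sumFin≡sumSplits : ∀ n (h : ℕ → ℕ → ℚ) → sumFin (suc n) (λ i → h (toℕ i) (n ∸ toℕ i)) ≡ sumSplits n h
sumFin≡sumSplits zero h = QP.+-identityʳ (h 0 0)
sumFin≡sumSplits (suc n) h = cong (h 0 (suc n) +_) (sumFin≡sumSplits n (λ k j → h (suc k) j))

compF-fuel-irrelevant : ∀ f g m → m ≤ f → m ≤ g → compF f m ≡ compF g m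
compF-fuel-irrelevant f g zero _ _ = refl
compF-fuel-irrelevant (suc f) (suc g) (suc m) (s≤s lf) (s≤s lg) =
  LP.concatMap-cong (λ k → cong (map (suc (toℕ k) ∷_)) (compF-fuel-irrelevant f g (m ∸ toℕ k) (ℕP.≤-trans (ℕP.m∸n≤m m (toℕ k)) lf) (ℕP.≤-trans (ℕP.m∸n≤m m (toℕ k)) lg))) (allFin (suc m))

sumCompositions : ℕ → (List ℕ → ℚ) → ℚ
sumCompositions n f = sumOver (indices n) f

sumCompositions-suc : ∀ n f → sumCompositions (suc n) f ≡ sumSplits n (λ k j → sumCompositions j (λ l → f (suc k ∷ l)))
sumCompositions-suc n f = begin
  sumOver (concatMap (λ k → map (suc (toℕ k) ∷_) (compF n (n ∸ toℕ k))) (allFin (suc n))) f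
    ≡⟨ sumOver-concatMap (λ k → map (suc (toℕ k) ∷_) (compF n (n ∸ toℕ k))) (allFin (suc n)) f ⟩
  sumOver (allFin (suc n)) (λ k → sumOver (map (suc (toℕ k) ∷_) (compF n (n ∸ toℕ k))) f)
    ≡⟨ sumOver-cong (allFin (suc n)) (λ k → trans (sumOver-map (suc (toℕ k) ∷_) (compF n (n ∸ toℕ k)) f) (cong (λ L → sumOver L (λ l → f (suc (toℕ k) ∷ l))) (compF-fuel-irrelevant n (n ∸ toℕ k) (n ∸ toℕ k) (ℕP.m∸n≤m n (toℕ k)) ℕP.≤-refl))) ⟩
  sumOver (allFin (suc n)) (λ k → sumCompositions (n ∸ toℕ k) (λ l → f (suc (toℕ k) ∷ l)))
    ≡⟨ sumOver-tabulate (suc n) (λ i → i) (λ k → sumCompositions (n ∸ toℕ k) (λ l → f (suc (toℕ k) ∷ l))) ⟩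
  sumFin (suc n) (λ k → sumCompositions (n ∸ toℕ k) (λ l → f (suc (toℕ k) ∷ l)))
    ≡⟨ sumFin≡sumSplits n (λ k j → sumCompositions j (λ l → f (suc k ∷ l))) ⟩
  sumSplits n (λ k j → sumCompositions j (λ l → f (suc k ∷ l))) ∎

sumCompositions-+ : ∀ n f g → sumCompositions n (λ l → f l + g l) ≡ sumCompositions n f + sumCompositions n g
sumCompositions-+ n f g = sumOver-+ (indices n) f g

sumCompositions-cong : ∀ n {f g} → (∀ l → f l ≡ g l) → sumCompositions n f ≡ sumCompositions n g
sumCompositions-cong n e = sumOver-cong (indices n) e

-- The children (l′, i) of an index l are those with l′^(i) = l: some part of l grows
-- by one, or a part 1 is inserted (possibly at the end).
children : List ℕ → List (List ℕ × ℕ)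
children [] = (1 ∷ [] , 0) ∷ []
children (k ∷ l) = (suc k ∷ l , 0) ∷ (1 ∷ k ∷ l , 0) ∷ map (λ li → (k ∷ proj₁ li , suc (proj₂ li))) (children l)

sumChildren : ℕ → (List ℕ × ℕ → ℚ) → ℚ
sumChildren n G = sumCompositions n (λ l → sumOver (children l) G)

sumPositions : ℕ → (List ℕ × ℕ → ℚ) → ℚ
sumPositions n G = sumCompositions n (λ l → sumUpTo (length l) (λ i → G (l , i)))

prefixed : ℕ → (List ℕ × ℕ → ℚ) → (List ℕ × ℕ → ℚ)
prefixed k G (l , i) = G (suc k ∷ l , suc i)

sumChildren-suc : ∀ n G → sumChildren (suc n) G ≡
  sumSplits n (λ k j → sumCompositions j (λ l → G (suc (suc k) ∷ l , 0)))
  + (sumSplits n (λ k j → sumCompositions j (λ l → G (1 ∷ suc k ∷ l , 0)))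
     + sumSplits n (λ k j → sumChildren j (prefixed k G)))
sumChildren-suc n G = begin
  sumChildren (suc n) G
    ≡⟨ sumCompositions-suc n (λ l → sumOver (children l) G) ⟩
  sumSplits n (λ k j → sumCompositions j (λ l → sumOver (children (suc k ∷ l)) G))
    ≡⟨ sumSplits-cong n (λ k j _ → trans (sumCompositions-cong j (λ l → cong (λ t → A k l + (B k l + t)) (sumOver-map _ (children l) G)))
                                        (trans (sumCompositions-+ j (A k) _) (cong (sumCompositions j (A k) +_) (sumCompositions-+ j (B k) _)))) ⟩
  sumSplits n (λ k j → sumCompositions j (A k) + (sumCompositions j (B k) + sumChildren j (prefixed k G)))
    ≡⟨ sumSplits-+ n (λ k j → sumCompositions j (A k)) _ ⟩
  sumSplits n (λ k j → sumCompositions j (A k)) + sumSplits n (λ k j → sumCompositions j (B k) + sumChildren j (prefixed k G))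
    ≡⟨ cong (sumSplits n (λ k j → sumCompositions j (A k)) +_) (sumSplits-+ n (λ k j → sumCompositions j (B k)) _) ⟩
  sumSplits n (λ k j → sumCompositions j (A k)) + (sumSplits n (λ k j → sumCompositions j (B k)) + sumSplits n (λ k j → sumChildren j (prefixed k G))) ∎
  where
  A B : ℕ → List ℕ → ℚ
  A k l = G (suc (suc k) ∷ l , 0)
  B k l = G (1 ∷ suc k ∷ l , 0)

sumPositions-suc : ∀ n G → sumPositions (suc n) G ≡
  sumSplits n (λ k j → sumCompositions j (λ l → G (suc k ∷ l , 0)) + sumPositions j (prefixed k G))
sumPositions-suc n G = trans (sumCompositions-suc n (λ l → sumUpTo (length l) (λ i → G (l , i))))
                             (sumSplits-cong n (λ k j _ → sumCompositions-+ j (λ l → G (suc k ∷ l , 0)) _))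

-- Every (l′, i) with |l′| = n + 1 is a child of exactly one index of weight n, namely l′^(i).
sumChildren≡sumPositions : ∀ n G → sumChildren n G ≡ sumPositions (suc n) G
sumChildren≡sumPositions n = bounded n n ℕP.≤-refl
  where
  bounded : ∀ N n → n ≤ N → ∀ G → sumChildren n G ≡ sumPositions (suc n) G
  bounded N zero _ G = refl
  bounded (suc N) (suc n) (s≤s n≤N) G = begin
    sumChildren (suc n) G
      ≡⟨ sumChildren-suc n G ⟩
    ΣA + (ΣB + sumSplits n (λ k j → sumChildren j (prefixed k G)))
      ≡⟨ cong (λ t → ΣA + (ΣB + t)) (sumSplits-cong n (λ k j k+j≡n → bounded N j (ℕP.≤-trans (ℕP.≤-trans (ℕP.m≤n+m j k) (ℕP.≤-reflexive k+j≡n)) n≤N) (prefixed k G))) ⟩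
    ΣA + (ΣB + sumSplits n (λ k j → sumPositions (suc j) (prefixed k G)))
      ≡⟨ cong (λ t → ΣA + (ΣB + t)) (sym (trans (sumSplits-last n (λ k j → sumPositions j (prefixed k G))) (QP.+-identityʳ _))) ⟩
    ΣA + (ΣB + (P₀ + Pₛ))
      ≡⟨ solve 4 (λ a b r s → a :+ (b :+ (r :+ s)) := (b :+ r) :+ (a :+ s)) refl ΣA ΣB P₀ Pₛ ⟩
    (ΣB + P₀) + (ΣA + Pₛ)
      ≡⟨ cong₂ _+_ (cong (_+ P₀) (sym (sumCompositions-suc n (λ l → G (1 ∷ l , 0)))))
                   (sym (sumSplits-+ n (λ k j → sumCompositions j (λ l → G (suc (suc k) ∷ l , 0))) (λ k j → sumPositions j (prefixed (suc k) G)))) ⟩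
    sumSplits (suc n) (λ k j → sumCompositions j (λ l → G (suc k ∷ l , 0)) + sumPositions j (prefixed k G))
      ≡⟨ sym (sumPositions-suc (suc n) G) ⟩
    sumPositions (suc (suc n)) G ∎
    where
    ΣA = sumSplits n (λ k j → sumCompositions j (λ l → G (suc (suc k) ∷ l , 0)))
    ΣB = sumSplits n (λ k j → sumCompositions j (λ l → G (1 ∷ suc k ∷ l , 0)))
    P₀ = sumPositions (suc n) (prefixed 0 G)
    Pₛ = sumSplits n (λ k j → sumPositions j (prefixed (suc k) G))

partAt : List ℕ → ℕ → ℕ
partAt [] _ = 0
partAt (k ∷ _) zero = k
partAt (_ ∷ l) (suc i) = partAt l i

lower : ℕ → List ℕ
lower (suc (suc k)) = [ suc k ]
lower _ = []

removeAt : List ℕ → ℕ → List ℕ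
removeAt l i = take i l ++ lower (partAt l i) ++ drop (suc i) l

lookup≡partAt : ∀ (l : List ℕ) (i : Fin (length l)) → lookup l i ≡ partAt l (toℕ i)
lookup≡partAt (k ∷ l) fzero = refl
lookup≡partAt (k ∷ l) (fsuc i) = lookup≡partAt l i

sum-removeAt : ∀ l i → IsIndex l → i < length l → suc (sum (removeAt l i)) ≡ sum l
sum-removeAt (suc zero ∷ l) zero _ _ = refl
sum-removeAt (suc (suc k) ∷ l) zero _ _ = refl
sum-removeAt (k ∷ l) (suc i) (_ ∷ l-index) (s≤s i<n) =
  trans (sym (ℕP.+-suc k (sum (removeAt l i)))) (cong (k ℕ.+_) (sum-removeAt l i l-index i<n))

-- Removing position i of l′ deletes a part, flipping the sign (−1)^s, exactly when l′ᵢ = 1.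
signChange : ℕ → ℚ
signChange (suc zero) = - 1ℚ
signChange _ = 1ℚ

signChange²≡1 : ∀ n → signChange n * signChange n ≡ 1ℚ
signChange²≡1 zero = refl
signChange²≡1 (suc zero) = refl
signChange²≡1 (suc (suc n)) = refl

IsChildOf : List ℕ → List ℕ × ℕ → Set
IsChildOf l li = (removeAt (proj₁ li) (proj₂ li) ≡ l)
               × (signChange (partAt (proj₁ li) (proj₂ li)) * sign (length (proj₁ li)) ≡ sign (length l))

children-IsChildOf : ∀ l → IsIndex l → All (IsChildOf l) (children l)
children-IsChildOf [] [] = (refl , refl) ∷ []
children-IsChildOf (suc j ∷ l) (_ ∷ l-index) =
  (refl , QP.*-identityˡ (sign (suc (length l)))) ∷
  (refl , solve 1 (λ S → con (- 1ℚ) :* (con (- 1ℚ) :* (con (- 1ℚ) :* S)) := con (- 1ℚ) :* S) refl (sign (length l))) ∷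
  AllP.map⁺ (All.map (λ {li} → prefix-child li) (children-IsChildOf l l-index))
  where
  prefix-child : ∀ li → IsChildOf l li → IsChildOf (suc j ∷ l) (suc j ∷ proj₁ li , suc (proj₂ li))
  prefix-child (l′ , i) (removed , signs) =
    cong (suc j ∷_) removed ,
    trans (solve 2 (λ g S → g :* (con (- 1ℚ) :* S) := con (- 1ℚ) :* (g :* S)) refl (signChange (partAt l′ i)) (sign (length l′)))
          (cong (- 1ℚ *_) signs)

indices-IsIndex : ∀ f n → All (λ l → IsIndex l × sum l ≡ n) (compF f n)
indices-IsIndex f zero = ([] , refl) ∷ []
indices-IsIndex zero (suc n) = []
indices-IsIndex (suc f) (suc n) =
  AllP.concat⁺ (AllP.map⁺ (AllP.tabulate⁺ λ k → AllP.map⁺ (All.map (prefix k) (indices-IsIndex f (n ∸ toℕ k)))))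
  where
  prefix : ∀ k {l} → IsIndex l × sum l ≡ n ∸ toℕ k → IsIndex (suc (toℕ k) ∷ l) × sum (suc (toℕ k) ∷ l) ≡ suc n
  prefix k (l-index , sum≡) =
    s≤s z≤n ∷ l-index , cong suc (trans (cong (toℕ k ℕ.+_) sum≡) (ℕP.m+[n∸m]≡n (ℕP.≤-pred (FP.toℕ<n k))))

sumCombination : Combination → (List ℕ → ℚ) → ℚ
sumCombination [] F = 0ℚ
sumCombination ((q , l) ∷ S) F = q * F l + sumCombination S F

coeff-⟦⟧ : ∀ S w → coeff ⟦ S ⟧ w ≡ sumCombination S (λ l → coeff (wordPart l) w)
coeff-⟦⟧ [] w = refl
coeff-⟦⟧ ((q , l) ∷ S) w = trans (coeff-++ (q · wordPart l) ⟦ S ⟧ w) (cong₂ _+_ (coeff-· q (wordPart l) w) (coeff-⟦⟧ S w))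

sumCombination-prepend : ∀ k S F → sumCombination (prepend k S) F ≡ sumCombination S (λ l → F (k ∷ l))
sumCombination-prepend k [] F = refl
sumCombination-prepend k ((q , l) ∷ S) F = cong (q * F (k ∷ l) +_) (sumCombination-prepend k S F)

coeff-concatMap : ∀ {A : Set} (g : A → Poly) L w → coeff (concatMap g L) w ≡ sumOver L (λ e → coeff (g e) w)
coeff-concatMap g [] w = refl
coeff-concatMap g (e ∷ L) w = trans (coeff-++ (g e) (concatMap g L) w) (cong (coeff (g e) w +_) (coeff-concatMap g L w))

wordPart-1 : wordPart (1 ∷ []) ≡ Y
wordPart-1 = trans (⊗-identityʳ (Y ⊗ one)) (⊗-identityʳ Y)

module _ (c : ℚ) where
  open Θ-Calculus c

  -- K is the weight of the parts to the left of l, when l is the tail of an index.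
  weightAt : ℕ → List ℕ → ℕ → ℚ
  weightAt K l i = ℚ⟨ partAt l i ⟩ - 1ℚ - ℚ⟨ K ℕ.+ sum (take i l) ⟩ * c

  a-recursion : ∀ l n → IsIndex l → sum l ≡ suc (suc n) →
    a c l ≡ sumUpTo (length l) (λ i → weightAt 0 l i * a c (removeAt l i))
  a-recursion l n l-index sum≡ = begin
    aF c (sum l) l                  ≡⟨ cong (λ f → aF c f l) sum≡ ⟩
    aF c (suc (suc n)) l            ≡⟨ sumℚ-map _ (allFin (length l)) ⟩
    sumOver (allFin (length l)) _   ≡⟨ sumOver-tabulate (length l) (λ i → i) _ ⟩
    sumFin (length l) _             ≡⟨ sumFin-cong (length l) term ⟩
    sumFin (length l) (λ i → weightAt 0 l (toℕ i) * a c (removeAt l (toℕ i)))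
      ≡⟨ sumFin-toℕ (length l) (λ i → weightAt 0 l i * a c (removeAt l i)) ⟩
    sumUpTo (length l) (λ i → weightAt 0 l i * a c (removeAt l i)) ∎
    where
    sumℚ-map : ∀ {A : Set} (g : A → ℚ) L → sumℚ c (map g L) ≡ sumOver L g
    sumℚ-map g [] = refl
    sumℚ-map g (e ∷ L) = cong (g e +_) (sumℚ-map g L)
    remove≡removeAt : ∀ (i : Fin (length l)) → remove c l i ≡ removeAt l (toℕ i)
    remove≡removeAt i with lookup l i | lookup≡partAt l i
    ... | zero | eq rewrite sym eq = refl
    ... | suc zero | eq rewrite sym eq = refl
    ... | suc (suc k) | eq rewrite sym eq = refl
    term : ∀ (i : Fin (length l)) →
      (ℚ[_] c (lookup l i) - 1ℚ - ℚ[_] c (weight c (take (toℕ i) l)) * c) * aF c (suc n) (remove c l i)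
      ≡ weightAt 0 l (toℕ i) * a c (removeAt l (toℕ i))
    term i = cong₂ _*_ (cong (λ v → ℚ⟨ v ⟩ - 1ℚ - ℚ⟨ sum (take (toℕ i) l) ⟩ * c) (lookup≡partAt l i))
                       (trans (cong (aF c (suc n)) (remove≡removeAt i))
                              (cong (λ f → aF c f (removeAt l (toℕ i))) (sym (ℕP.suc-injective (trans (sum-removeAt l (toℕ i) l-index (FP.toℕ<n i)) sum≡)))))

  childTerm : ℕ → (List ℕ → ℚ) → List ℕ × ℕ → ℚ
  childTerm K F (l , i) = signChange (partAt l i) * weightAt K l i * F l

  sumCombination-expansion : ∀ K l F → IsIndex l → sumCombination (expansion K l) F ≡ sumOver (children l) (childTerm K F)
  sumCombination-expansion K [] F [] =
    cong (_+ 0ℚ) (trans (cong (λ n → c * ℚ⟨ n ⟩ * F (1 ∷ [])) (sym (ℕP.+-identityʳ K)))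
                        (solve 3 (λ c k f → c :* k :* f := con (- 1ℚ) :* ((con 1ℚ :- con 1ℚ) :- k :* c) :* f) refl c ℚ⟨ K ℕ.+ 0 ⟩ (F (1 ∷ []))))
  sumCombination-expansion K (suc j ∷ l) F (_ ∷ l-index) = cong₂ _+_ grow (cong₂ _+_ insert rest)
    where
    grow : (ℚ⟨ suc j ⟩ - c * ℚ⟨ K ⟩) * F (suc (suc j) ∷ l) ≡ 1ℚ * (ℚ⟨ suc (suc j) ⟩ - 1ℚ - ℚ⟨ K ℕ.+ 0 ⟩ * c) * F (suc (suc j) ∷ l)
    grow = begin
      (ℚ⟨ suc j ⟩ - c * ℚ⟨ K ⟩) * F (suc (suc j) ∷ l)
        ≡⟨ cong (λ n → (ℚ⟨ suc j ⟩ - c * ℚ⟨ n ⟩) * F (suc (suc j) ∷ l)) (sym (ℕP.+-identityʳ K)) ⟩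
      (ℚ⟨ suc j ⟩ - c * ℚ⟨ K ℕ.+ 0 ⟩) * F (suc (suc j) ∷ l)
        ≡⟨ solve 4 (λ c a k f → (a :- c :* k) :* f := con 1ℚ :* ((a :+ con 1ℚ) :- con 1ℚ :- k :* c) :* f) refl c ℚ⟨ suc j ⟩ ℚ⟨ K ℕ.+ 0 ⟩ (F (suc (suc j) ∷ l)) ⟩
      1ℚ * ((ℚ⟨ suc j ⟩ + 1ℚ) - 1ℚ - ℚ⟨ K ℕ.+ 0 ⟩ * c) * F (suc (suc j) ∷ l)
        ≡⟨ cong (λ t → 1ℚ * (t - 1ℚ - ℚ⟨ K ℕ.+ 0 ⟩ * c) * F (suc (suc j) ∷ l)) (sym (ℚ⟨suc⟩ (suc j))) ⟩
      1ℚ * (ℚ⟨ suc (suc j) ⟩ - 1ℚ - ℚ⟨ K ℕ.+ 0 ⟩ * c) * F (suc (suc j) ∷ l) ∎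
    insert : c * ℚ⟨ K ⟩ * F (1 ∷ suc j ∷ l) ≡ - 1ℚ * (1ℚ - 1ℚ - ℚ⟨ K ℕ.+ 0 ⟩ * c) * F (1 ∷ suc j ∷ l)
    insert = trans (cong (λ n → c * ℚ⟨ n ⟩ * F (1 ∷ suc j ∷ l)) (sym (ℕP.+-identityʳ K)))
                   (solve 3 (λ c k f → c :* k :* f := con (- 1ℚ) :* ((con 1ℚ :- con 1ℚ) :- k :* c) :* f) refl c ℚ⟨ K ℕ.+ 0 ⟩ (F (1 ∷ suc j ∷ l)))
    rest : sumCombination (prepend (suc j) (expansion (K ℕ.+ suc j) l)) F
           ≡ sumOver (map (λ li → (suc j ∷ proj₁ li , suc (proj₂ li))) (children l)) (childTerm K F)
    rest = begin
      sumCombination (prepend (suc j) (expansion (K ℕ.+ suc j) l)) F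
        ≡⟨ sumCombination-prepend (suc j) (expansion (K ℕ.+ suc j) l) F ⟩
      sumCombination (expansion (K ℕ.+ suc j) l) (λ l′ → F (suc j ∷ l′))
        ≡⟨ sumCombination-expansion (K ℕ.+ suc j) l (λ l′ → F (suc j ∷ l′)) l-index ⟩
      sumOver (children l) (childTerm (K ℕ.+ suc j) (λ l′ → F (suc j ∷ l′)))
        ≡⟨ sumOver-cong (children l) (λ (l′ , i) → cong (λ n → signChange (partAt l′ i) * (ℚ⟨ partAt l′ i ⟩ - 1ℚ - ℚ⟨ n ⟩ * c) * F (suc j ∷ l′))
                                                      (ℕP.+-assoc K (suc j) (sum (take i l′)))) ⟩
      sumOver (children l) (λ li → childTerm K F (suc j ∷ proj₁ li , suc (proj₂ li)))
        ≡⟨ sym (sumOver-map (λ li → (suc j ∷ proj₁ li , suc (proj₂ li))) (children l) (childTerm K F)) ⟩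
      sumOver (map (λ li → (suc j ∷ proj₁ li , suc (proj₂ li))) (children l)) (childTerm K F) ∎

  S : ℕ → Poly
  S n = concatMap (λ l → a c l · wl l) (indices n)

  coeff-a·wl : ∀ l w → coeff (a c l · wl l) w ≡ a c l * (sign (length l) * coeff (wordPart l) w)
  coeff-a·wl l w = trans (coeff-· (a c l) (wl l) w) (cong (a c l *_) (coeff-· (sign (length l)) (wordPart l) w))

  coeff-θ̃-concatMap : ∀ {A : Set} (g : A → Poly) L w → coeff (θ̃ c (concatMap g L)) w ≡ sumOver L (λ e → coeff (θ̃ c (g e)) w)
  coeff-θ̃-concatMap g [] w = refl
  coeff-θ̃-concatMap g (e ∷ L) w = trans (coeff-θ̃-++ (g e) (concatMap g L) w) (cong (coeff (θ̃ c (g e)) w +_) (coeff-θ̃-concatMap g L w))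

  positionTerm : Word → List ℕ × ℕ → ℚ
  positionTerm w (l , i) = sign (length l) * coeff (wordPart l) w * weightAt 0 l i * a c (removeAt l i)

  θ̃-a·wl≡sumChildren : ∀ l w → IsIndex l →
    a c l * (sign (length l) * coeff (θ̃ c (wordPart l)) w) ≡ sumOver (children l) (positionTerm w)
  θ̃-a·wl≡sumChildren l w l-index = begin
    a c l * (sign (length l) * coeff (θ̃ c (wordPart l)) w)
      ≡⟨ cong (λ t → a c l * (sign (length l) * t)) (trans (at (θ̃-wordPart l l-index) w) (trans (coeff-⟦⟧ (expansion 0 l) w) (sumCombination-expansion 0 l W l-index))) ⟩
    a c l * (sign (length l) * sumOver (children l) (childTerm 0 W))
      ≡⟨ cong (a c l *_) (sym (sumOver-* (children l) (sign (length l)) (childTerm 0 W))) ⟩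
    a c l * sumOver (children l) (λ li → sign (length l) * childTerm 0 W li)
      ≡⟨ sym (sumOver-* (children l) (a c l) _) ⟩
    sumOver (children l) (λ li → a c l * (sign (length l) * childTerm 0 W li))
      ≡⟨ sumOver-cong-All (children-IsChildOf l l-index) child ⟩
    sumOver (children l) (positionTerm w) ∎
    where
    W : List ℕ → ℚ
    W l′ = coeff (wordPart l′) w
    child : ∀ li → IsChildOf l li → a c l * (sign (length l) * childTerm 0 W li) ≡ positionTerm w li
    child (l′ , i) (removed , signs) = begin
      a c l * (sign (length l) * (g * k * W l′))
        ≡⟨ cong₂ (λ u v → a c u * (v * (g * k * W l′))) (sym removed) (sym signs) ⟩
      a c (removeAt l′ i) * ((g * σ) * (g * k * W l′))
        ≡⟨ solve 5 (λ A g σ k W → A :* ((g :* σ) :* (g :* k :* W)) := (g :* g) :* (σ :* W :* k :* A)) refl (a c (removeAt l′ i)) g σ k (W l′) ⟩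
      (g * g) * (σ * W l′ * k * a c (removeAt l′ i))
        ≡⟨ cong (_* (σ * W l′ * k * a c (removeAt l′ i))) (signChange²≡1 (partAt l′ i)) ⟩
      1ℚ * (σ * W l′ * k * a c (removeAt l′ i))
        ≡⟨ QP.*-identityˡ _ ⟩
      σ * W l′ * k * a c (removeAt l′ i) ∎
      where
      g = signChange (partAt l′ i)
      k = weightAt 0 l′ i
      σ = sign (length l′)

  sumPositions≡a·wl : ∀ l n w → IsIndex l → sum l ≡ suc (suc n) →
    sumUpTo (length l) (λ i → positionTerm w (l , i)) ≡ a c l * (sign (length l) * coeff (wordPart l) w)
  sumPositions≡a·wl l n w l-index sum≡ = begin
    sumUpTo (length l) (λ i → positionTerm w (l , i))
      ≡⟨ sumUpTo-cong (length l) (λ i → solve 4 (λ σ W k A → σ :* W :* k :* A := (σ :* W) :* (k :* A)) refl σ W (weightAt 0 l i) (a c (removeAt l i))) ⟩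
    sumUpTo (length l) (λ i → (σ * W) * (weightAt 0 l i * a c (removeAt l i)))
      ≡⟨ sumUpTo-* (length l) (σ * W) (λ i → weightAt 0 l i * a c (removeAt l i)) ⟩
    (σ * W) * sumUpTo (length l) (λ i → weightAt 0 l i * a c (removeAt l i))
      ≡⟨ cong ((σ * W) *_) (sym (a-recursion l n l-index sum≡)) ⟩
    (σ * W) * a c l
      ≡⟨ QP.*-comm (σ * W) (a c l) ⟩
    a c l * (σ * W) ∎
    where
    σ = sign (length l)
    W = coeff (wordPart l) w

  θ̃-S : ∀ n → θ̃ c (S (suc n)) ≈ S (suc (suc n))
  θ̃-S n = ≈i λ w → begin
    coeff (θ̃ c (S (suc n))) w
      ≡⟨ coeff-θ̃-concatMap (λ l → a c l · wl l) (indices (suc n)) w ⟩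
    sumCompositions (suc n) (λ l → coeff (θ̃ c (a c l · wl l)) w)
      ≡⟨ sumCompositions-cong (suc n) (λ l → trans (coeff-θ̃-· (a c l) (wl l) w) (cong (a c l *_) (coeff-θ̃-· (sign (length l)) (wordPart l) w))) ⟩
    sumCompositions (suc n) (λ l → a c l * (sign (length l) * coeff (θ̃ c (wordPart l)) w))
      ≡⟨ sumOver-cong-All (indices-IsIndex (suc n) (suc n)) (λ l (l-index , _) → θ̃-a·wl≡sumChildren l w l-index) ⟩
    sumChildren (suc n) (positionTerm w)
      ≡⟨ sumChildren≡sumPositions (suc n) (positionTerm w) ⟩
    sumPositions (suc (suc n)) (positionTerm w)
      ≡⟨ sumOver-cong-All (indices-IsIndex (suc (suc n)) (suc (suc n))) (λ l (l-index , sum≡) → sumPositions≡a·wl l n w l-index sum≡) ⟩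
    sumCompositions (suc (suc n)) (λ l → a c l * (sign (length l) * coeff (wordPart l) w))
      ≡⟨ sym (trans (coeff-concatMap (λ l → a c l · wl l) (indices (suc (suc n))) w) (sumCompositions-cong (suc (suc n)) (λ l → coeff-a·wl l w))) ⟩
    coeff (S (suc (suc n))) w ∎

  iterate-θ̃-Y : ∀ n → iter c n (θ̃ c) Y ≈ (- 1ℚ) · S (suc n)
  iterate-θ̃-Y zero = ≈i λ w → sym (begin
    coeff ((- 1ℚ) · S 1) w
      ≡⟨ coeff-· (- 1ℚ) (S 1) w ⟩
    - 1ℚ * coeff (a c (1 ∷ []) · wl (1 ∷ []) ++ []) w
      ≡⟨ cong (- 1ℚ *_) (trans (coeff-++ (a c (1 ∷ []) · wl (1 ∷ [])) [] w) (cong (_+ 0ℚ) (coeff-a·wl (1 ∷ []) w))) ⟩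
    - 1ℚ * (1ℚ * (sign 1 * coeff (wordPart (1 ∷ [])) w) + 0ℚ)
      ≡⟨ cong (λ t → - 1ℚ * (1ℚ * (sign 1 * coeff t w) + 0ℚ)) wordPart-1 ⟩
    - 1ℚ * (1ℚ * (sign 1 * coeff Y w) + 0ℚ)
      ≡⟨ solve 1 (λ A → con (- 1ℚ) :* (con 1ℚ :* (con (sign 1) :* A) :+ con 0ℚ) := A) refl (coeff Y w) ⟩
    coeff Y w ∎)
  iterate-θ̃-Y (suc n) = ≈-trans (θ̃-resp-≈ (iterate-θ̃-Y n)) (≈i λ w → begin
    coeff (θ̃ c ((- 1ℚ) · S (suc n))) w ≡⟨ coeff-θ̃-· (- 1ℚ) (S (suc n)) w ⟩
    - 1ℚ * coeff (θ̃ c (S (suc n))) w   ≡⟨ cong (- 1ℚ *_) (at (θ̃-S n) w) ⟩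
    - 1ℚ * coeff (S (suc (suc n))) w   ≡⟨ sym (coeff-· (- 1ℚ) (S (suc (suc n))) w) ⟩
    coeff ((- 1ℚ) · S (suc (suc n))) w ∎)

proposition3p1 : (c : ℚ) (n : ℕ) → 1 ≤ n →
    (w : Word) → coeff (qn c n) w ≡ coeff (rhs c n) w
proposition3p1 c (suc n) _ w = begin
  coeff (qn c (suc n)) w                    ≡⟨ coeff-· r (iter c n (θ̃ c) Y) w ⟩
  r * coeff (iter c n (θ̃ c) Y) w            ≡⟨ cong (r *_) (at (iterate-θ̃-Y c n) w) ⟩
  r * coeff ((- 1ℚ) · S c (suc n)) w      ≡⟨ cong (r *_) (coeff-· (- 1ℚ) (S c (suc n)) w) ⟩
  r * (- 1ℚ * coeff (S c (suc n)) w)      ≡⟨ solve 2 (λ r B → r :* (con (- 1ℚ) :* B) := (:- r) :* B) refl r (coeff (S c (suc n)) w) ⟩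
  (- r) * coeff (S c (suc n)) w           ≡⟨ sym (coeff-· (- r) (S c (suc n)) w) ⟩
  coeff (rhs c (suc n)) w                   ∎
  where
  r : ℚ
  r = ((ℤ.+ 1) / (n !)) {{n !≢0}}
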